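{- Let $n>1$ and let $\lambda$ be a partition with $1\le|\lambda|\le n+1$. Then $$\mathcal{D}_{n,\lambda}=\bigsqcup_{j}\{(\lambda'_{j+1},\beta_1,\dots,\beta_{n-1}):\beta\in\mathcal{D}_{n-1,\lambda^{(j)}}\},$$ where $j$ ranges over the integers $j\ge0$ for which $\lambda^{(j)}$ is defined, except that $j=0$ is excluded when $|\lambda|=n+1$; the union is disjoint. Moreover, $\mathcal{D}_{1,(1)}=\{(1)\}$ and $\mathcal{D}_{1,(2)}=\mathcal{D}_{1,(1,1)}=\{(0)\}$.
   Context: For a partition $\lambda$, $\lambda'$ is its conjugate. $\lambda^{(0)}:=\lambda$, and for $j\ge1$, $\lambda^{(j)}$ is the partition whose conjugate is obtained from $\lambda'$ by decreasing its $j$-th entry by $1$; it is defined exactly when the rightmost box of row $j$ of the Young diagram of $\lambda'$ is the bottommost box of its column (i.e. $\lambda'_j>\lambda'_{j+1}$). Container diagrams: for a partition $\mu$ (possibly empty) and $m\ge1$, consider the Young diagram of $\mu'$ (row $i$ from the top has boxes in columns $1,\dots,\mu'_i$; column $c$ has $\mu_c$ boxes), columns indexed by all positive integers. A container diagram of $(m,\mu)$ places each of $1,\dots,m$ exactly once either in a box or floating above row 1 in some column, such that each box has at most one number, numbers strictly decrease top to bottom in each column (floating numbers above all boxes), and an empty box has no number above it in its column. Equivalently: an ordered sequence $(S_1,S_2,\dots)$ of disjoint sets with union $[m]$, elements of $S_c$ placed in column $c$ decreasingly from top to bottom with the smallest in row $\mu_c$, extras floating, unfilled top boxes empty. $\mathcal{OP}_{m,\mu}$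 is the set of these. Treating empty boxes as $\infty$, $\mathsf{code}(\sigma)$ is the length-$m$ sequence whose $i$-th entry is: if $i$ is in a box in row $r$, column $c$, the number of boxes in row $r$ in columns $>c$ or in row $r+1$ in columns $<c$ containing a number larger than $i$; if $i$ floats in column $c$, $c-1$ plus the number of boxes in row 1 in columns $>c$ containing a number larger than $i$. $\mathcal{D}_{m,\mu}$ is the set of $\mathsf{code}(\sigma)$ for $\sigma\in\mathcal{OP}_{m,\mu}$ satisfying: (1) exactly one box is empty; (2) box entries decrease from left to right in each row and the empty box is in row 1, column 1; (3) if $i$ floats in column $c$, every column $c'<c$ contains a box that is empty or contains a number larger than $i$. (In particular $\mathcal{D}_{m,\mu}=\emptyset$ when $\mu$ is the empty partition.) -}

module Defs where

open import Data.Nat.Base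
open import Data.Bool.Base using (Bool; true; false; if_then_else_; _∧_)
open import Data.Nat.ListAction using (sum)
open import Data.List.Base using (List; []; _∷_; map; length; upTo; allFin; foldr)
open import Data.Fin.Base using (Fin; toℕ)
open import Data.Maybe.Base using (Maybe; just; nothing; is-nothing)
open import Data.Product using (Σ; _×_; ∃-syntax)
open import Data.Sum using (_⊎_)
open import Data.List.Relation.Unary.All using (All)
open import Data.List.Relation.Unary.Linked using (Linked)
open import Relation.Binary.PropositionalEquality using (_≡_)
open import Relation.Nullary using (¬_)

countᵇ : {A : Set} → (A → Bool) → List A → ℕ
countᵇ p []       = 0
countᵇ p (x ∷ xs) = (if p x then 1 else 0) + countᵇ p xs

firstᵇ : {A : Set} → (A → Bool) → List A → Maybe A
firstᵇ p []       = nothing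
firstᵇ p (x ∷ xs) = if p x then just x else firstᵇ p xs

from1 : ℕ → List ℕ
from1 n = map suc (upTo n)

maxL : List ℕ → ℕ
maxL = foldr _⊔_ 0

IsPartition : List ℕ → Set
IsPartition xs = Linked _≥_ xs × All (λ x → 1 ≤ x) xs

-- 1-indexed entry λ_c (0 for c = 0 or c beyond the length)
part : List ℕ → ℕ → ℕ
part xs       zero          = 0
part []       (suc _)       = 0
part (x ∷ xs) (suc zero)    = x
part (x ∷ xs) (suc (suc c)) = part xs (suc c)

size : List ℕ → ℕ
size = sum

conj : List ℕ → List ℕ
conj xs = map (λ i → countᵇ (λ x → i ≤ᵇ x) xs) (from1 (maxL xs))

decAt : ℕ → List ℕ → List ℕ
decAt zero          xs       = xs
decAt (suc _)       []       = []
decAt (suc zero)    (x ∷ xs) = (x ∸ 1) ∷ xs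
decAt (suc (suc j)) (x ∷ xs) = x ∷ decAt (suc j) xs

lamj : List ℕ → ℕ → List ℕ
lamj xs zero    = xs
lamj xs (suc j) = conj (decAt (suc j) (conj xs))

Defined : List ℕ → ℕ → Set
Defined xs j = (j ≡ 0) ⊎ ((1 ≤ j) × (part (conj xs) (suc j) < part (conj xs) j))

-- Container diagrams of (m, μ)
-- A container diagram is given by σ : Fin m → ℕ, σ k = the column c ≥ 1
-- of the number toℕ k + 1 (i.e. the ordered set partition (S_1, S_2, ...)
-- with S_c = σ⁻¹(c)).

module _ {m : ℕ} (μ : List ℕ) (σ : Fin m → ℕ) where

  rank : Fin m → ℕ
  rank k = countᵇ (λ k' → (σ k' ≡ᵇ σ k) ∧ (toℕ k' <ᵇ toℕ k)) (allFin m)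

  -- k lies in a box (rather than floating): rank < μ_{σ k}
  InBox : Fin m → Set
  InBox k = rank k < part μ (σ k)

  inBoxᵇ : Fin m → Bool
  inBoxᵇ k = rank k <ᵇ part μ (σ k)

  -- row of k if it lies in a box (smallest of column c in row μ_c)
  rowOf : Fin m → ℕ
  rowOf k = part μ (σ k) ∸ rank k

  -- content of box (row r, column c), for 1 ≤ r ≤ μ_c; nothing = empty
  content : ℕ → ℕ → Maybe (Fin m)
  content r c = firstᵇ (λ k → (σ k ≡ᵇ c) ∧ (rank k ≡ᵇ (part μ c ∸ r))) (allFin m)

  -- box (r, c) is empty (= ∞) or contains a number larger than i
  bigᵇ : ℕ → ℕ → Fin m → Bool
  bigᵇ r c i with content r c
  ... | nothing = true
  ... | just k  = toℕ i <ᵇ toℕ k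

  cols : List ℕ
  cols = from1 (length μ)

  codeEntry : Fin m → ℕ
  codeEntry i =
    if inBoxᵇ i
    then countᵇ (λ c' → (σ i <ᵇ c') ∧ (rowOf i ≤ᵇ part μ c') ∧ bigᵇ (rowOf i) c' i) cols
       + countᵇ (λ c' → (c' <ᵇ σ i) ∧ (suc (rowOf i) ≤ᵇ part μ c') ∧ bigᵇ (suc (rowOf i)) c' i) cols
    else (σ i ∸ 1) + countᵇ (λ c' → (σ i <ᵇ c') ∧ (1 ≤ᵇ part μ c') ∧ bigᵇ 1 c' i) cols

  code : List ℕ
  code = map codeEntry (allFin m)

  emptyBoxes : ℕ
  emptyBoxes = sum (map (λ c → countᵇ (λ r → is-nothing (content r c)) (from1 (part μ c))) cols)

  IsContainer : Set
  IsContainer = ∀ k → 1 ≤ σ k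

  Cond1 : Set
  Cond1 = emptyBoxes ≡ 1

  Cond2 : Set
  Cond2 = (∀ r c c' k k' → 1 ≤ r → r ≤ part μ c → r ≤ part μ c' → c < c'
            → content r c ≡ just k → content r c' ≡ just k' → toℕ k' < toℕ k)
        × (1 ≤ part μ 1) × (content 1 1 ≡ nothing)

  Cond3 : Set
  Cond3 = ∀ i → ¬ InBox i → ∀ c' → 1 ≤ c' → c' < σ i →
            ∃[ r ] ((1 ≤ r) × (r ≤ part μ c') × (bigᵇ r c' i ≡ true))

D : (m : ℕ) → List ℕ → List ℕ → Set
D m μ α = Σ (Fin m → ℕ) λ σ →
  IsContainer μ σ × Cond1 μ σ × Cond2 μ σ × Cond3 μ σ × (code μ σ ≡ α)

ValidIndex : ℕ → List ℕ → ℕ → Set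
ValidIndex n xs j = Defined xs j × (j ≡ 0 → ¬ (size xs ≡ suc n))

-- Remove the number 1 from a diagram in D(n, λ). It is the lowest entry of its column c₀,
-- or floats there, and conditions (1)–(3) force c₀ to be the last column of λ of some height j
-- (for a floating 1, the first empty column, j = 0). Deleting that box turns λ into λ^(j), and
-- the remaining numbers form a diagram in D(n − 1, λ^(j)). The code entry of 1 is λ'_(j+1):
-- a boxed 1 sees exactly the columns to its left reaching one row deeper, a floating 1 sees
-- all ℓ(λ) = λ'₁ columns. Conversely, 1 can be put back at the bottom of column λ'_j of any
-- diagram in D(n − 1, λ^(j)). Since λ' drops strictly at every j where λ^(j) is defined,
-- λ'_(j+1) determines j. Finally, a floating 1 leaves λ unchanged and a diagram of λ with one
-- empty box and n − 1 numbers has |λ| ≤ n, which rules out j = 0 when |λ| = n + 1.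

module Submission where

open import Defs
open import Data.Nat.Base
open import Data.Nat.Properties
open import Data.Nat.ListAction using (sum)
open import Data.Nat.ListAction.Properties using (sum-++)
open import Data.Bool.Base using (Bool; true; false; if_then_else_; _∧_; T)
open import Data.Bool.Properties using (∧-identityʳ; ∧-zeroʳ; T-≡)
open import Data.List.Base using (List; []; _∷_; map; length; upTo; allFin; _++_)
open import Data.List.Properties
  using (∷-injectiveˡ; map-++; map-∘; map-cong; map-tabulate; upTo-∷ʳ; map-applyUpTo; length-map; length-upTo)
open import Data.Fin.Base using (Fin; zero; suc; toℕ)
import Data.Fin.Base as Fin
open import Data.Vec.Functional using () renaming (_∷_ to _∷ᶠ_)
open import Data.Maybe.Base using (Maybe; just; nothing; is-nothing) renaming (map to mapₘ)
open import Data.Product using (_×_; _,_; ∃-syntax)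
open import Data.Sum using (_⊎_; inj₁; inj₂)
open import Data.Empty using (⊥-elim)
open import Data.List.Relation.Unary.All using (All; []; _∷_)
open import Data.List.Relation.Unary.Linked using (Linked; [-]; _∷_) renaming (tail to Linked-tail)
open import Function.Base using (_∘_)
open import Function.Bundles using (_⇔_; mk⇔; Equivalence)
open import Relation.Binary.Definitions using (tri<; tri≈; tri>)
open import Relation.Binary.PropositionalEquality
open import Relation.Nullary using (¬_; yes; no)

𝟙 : Bool → ℕ
𝟙 b = if b then 1 else 0

T⇒≡true : ∀ {b} → T b → b ≡ true
T⇒≡true = Equivalence.to T-≡

≡true⇒T : ∀ {b} → b ≡ true → T b
≡true⇒T = Equivalence.from T-≡

≤⇒≤ᵇ≡true : ∀ {m n} → m ≤ n → (m ≤ᵇ n) ≡ true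
≤⇒≤ᵇ≡true = T⇒≡true ∘ ≤⇒≤ᵇ

>⇒≤ᵇ≡false : ∀ {m n} → n < m → (m ≤ᵇ n) ≡ false
>⇒≤ᵇ≡false {m} {n} n<m with m ≤ᵇ n in eq
... | false = refl
... | true  = ⊥-elim (<⇒≱ n<m (≤ᵇ⇒≤ m n (≡true⇒T eq)))

≤ᵇ≡true⇒≤ : ∀ {m n} → (m ≤ᵇ n) ≡ true → m ≤ n
≤ᵇ≡true⇒≤ {m} {n} = ≤ᵇ⇒≤ m n ∘ ≡true⇒T

<⇒<ᵇ≡true : ∀ {m n} → m < n → (m <ᵇ n) ≡ true
<⇒<ᵇ≡true = T⇒≡true ∘ <⇒<ᵇ

≥⇒<ᵇ≡false : ∀ {m n} → n ≤ m → (m <ᵇ n) ≡ false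
≥⇒<ᵇ≡false n≤m = >⇒≤ᵇ≡false (s≤s n≤m)

<ᵇ≡true⇒< : ∀ {m n} → (m <ᵇ n) ≡ true → m < n
<ᵇ≡true⇒< {m} {n} = <ᵇ⇒< m n ∘ ≡true⇒T

≡ᵇ-refl : ∀ m → (m ≡ᵇ m) ≡ true
≡ᵇ-refl m = T⇒≡true (≡⇒≡ᵇ m m refl)

≢⇒≡ᵇ≡false : ∀ {m n} → m ≢ n → (m ≡ᵇ n) ≡ false
≢⇒≡ᵇ≡false {m} {n} m≢n with m ≡ᵇ n in eq
... | false = refl
... | true  = ⊥-elim (m≢n (≡ᵇ⇒≡ m n (≡true⇒T eq)))

≡ᵇ≡true⇒≡ : ∀ {m n} → (m ≡ᵇ n) ≡ true → m ≡ n
≡ᵇ≡true⇒≡ {m} {n} = ≡ᵇ⇒≡ m n ∘ ≡true⇒T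

≤ᵇ-cong-⇔ : ∀ {a b c d} → (a ≤ b → c ≤ d) → (c ≤ d → a ≤ b) → (a ≤ᵇ b) ≡ (c ≤ᵇ d)
≤ᵇ-cong-⇔ {a} {b} {c} {d} to from with a ≤? b | c ≤? d
... | yes p | yes q = trans (≤⇒≤ᵇ≡true p) (sym (≤⇒≤ᵇ≡true q))
... | yes p | no ¬q = ⊥-elim (¬q (to p))
... | no ¬p | yes q = ⊥-elim (¬p (from q))
... | no ¬p | no ¬q = trans (>⇒≤ᵇ≡false (≰⇒> ¬p)) (sym (>⇒≤ᵇ≡false (≰⇒> ¬q)))

∧≡true⇒ˡ : ∀ {a b} → (a ∧ b) ≡ true → a ≡ true
∧≡true⇒ˡ {true} _ = refl

∧≡true⇒ʳ : ∀ {a b} → (a ∧ b) ≡ true → b ≡ true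
∧≡true⇒ʳ {true} e = e

∧-congˡ-guarded : ∀ a {x y} → (a ≡ true → x ≡ y) → (a ∧ x) ≡ (a ∧ y)
∧-congˡ-guarded true  x≡y = x≡y refl
∧-congˡ-guarded false _   = refl

if-cong : ∀ {A : Set} {b₁ b₂ : Bool} {x₁ x₂ y₁ y₂ : A} → b₁ ≡ b₂ →
          (b₂ ≡ true → x₁ ≡ x₂) → (b₂ ≡ false → y₁ ≡ y₂) →
          (if b₁ then x₁ else y₁) ≡ (if b₂ then x₂ else y₂)
if-cong {b₂ = true}  refl x₁≡x₂ _ = x₁≡x₂ refl
if-cong {b₂ = false} refl _ y₁≡y₂ = y₁≡y₂ refl

if-true : ∀ {A : Set} {b} {x y : A} → b ≡ true → (if b then x else y) ≡ x
if-true refl = refl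

if-false : ∀ {A : Set} {b} {x y : A} → b ≡ false → (if b then x else y) ≡ y
if-false refl = refl

countᵇ-cong : ∀ {A : Set} {p q : A → Bool} → (∀ x → p x ≡ q x) → ∀ xs → countᵇ p xs ≡ countᵇ q xs
countᵇ-cong p≗q []       = refl
countᵇ-cong p≗q (x ∷ xs) = cong₂ (λ b n → 𝟙 b + n) (p≗q x) (countᵇ-cong p≗q xs)

countᵇ-++ : ∀ {A : Set} (p : A → Bool) xs ys → countᵇ p (xs ++ ys) ≡ countᵇ p xs + countᵇ p ys
countᵇ-++ p []       ys = refl
countᵇ-++ p (x ∷ xs) ys =
  trans (cong (𝟙 (p x) +_) (countᵇ-++ p xs ys)) (sym (+-assoc (𝟙 (p x)) _ _))

countᵇ-map : ∀ {A B : Set} (p : B → Bool) (f : A → B) xs → countᵇ p (map f xs) ≡ countᵇ (p ∘ f) xs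
countᵇ-map p f []       = refl
countᵇ-map p f (x ∷ xs) = cong (𝟙 (p (f x)) +_) (countᵇ-map p f xs)

countᵇ-false : ∀ {A : Set} (p : A → Bool) → (∀ x → p x ≡ false) → ∀ xs → countᵇ p xs ≡ 0
countᵇ-false p p≡false []       = refl
countᵇ-false p p≡false (x ∷ xs) rewrite p≡false x = countᵇ-false p p≡false xs

countᵇ-antitone : ∀ xs {i i'} → i ≤ i' → countᵇ (i' ≤ᵇ_) xs ≤ countᵇ (i ≤ᵇ_) xs
countᵇ-antitone []       i≤i' = z≤n
countᵇ-antitone (x ∷ xs) {i} {i'} i≤i' with i' ≤? x
... | yes i'≤x rewrite ≤⇒≤ᵇ≡true i'≤x | ≤⇒≤ᵇ≡true (≤-trans i≤i' i'≤x) =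
  s≤s (countᵇ-antitone xs i≤i')
... | no i'≰x rewrite >⇒≤ᵇ≡false {i'} (≰⇒> i'≰x) =
  ≤-trans (countᵇ-antitone xs i≤i') (m≤n+m _ _)

firstᵇ-map : ∀ {A B : Set} (p : B → Bool) (f : A → B) xs →
             firstᵇ p (map f xs) ≡ mapₘ f (firstᵇ (p ∘ f) xs)
firstᵇ-map p f []       = refl
firstᵇ-map p f (x ∷ xs) with p (f x)
... | true  = refl
... | false = firstᵇ-map p f xs

firstᵇ-cong : ∀ {A : Set} {p q : A → Bool} → (∀ x → p x ≡ q x) → ∀ xs → firstᵇ p xs ≡ firstᵇ q xs
firstᵇ-cong p≗q []       = refl
firstᵇ-cong {q = q} p≗q (x ∷ xs) rewrite p≗q x with q x
... | true  = refl
... | false = firstᵇ-cong p≗q xs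

firstᵇ-sound : ∀ {A : Set} (p : A → Bool) xs {k} → firstᵇ p xs ≡ just k → p k ≡ true
firstᵇ-sound p (x ∷ xs) e with p x in px
firstᵇ-sound p (x ∷ xs) refl | true = px
... | false = firstᵇ-sound p xs e

firstᵇ-head-false : ∀ {A : Set} (p : A → Bool) x xs → p x ≡ false → firstᵇ p (x ∷ xs) ≡ firstᵇ p xs
firstᵇ-head-false p x xs px rewrite px = refl

firstᵇ-head-true : ∀ {A : Set} (p : A → Bool) x xs → p x ≡ true → firstᵇ p (x ∷ xs) ≡ just x
firstᵇ-head-true p x xs px rewrite px = refl

allFin-suc : ∀ m → allFin (suc m) ≡ zero ∷ map suc (allFin m)
allFin-suc m = cong (zero ∷_) (sym (map-tabulate (λ x → x) suc))

from1-suc : ∀ n → from1 (suc n) ≡ 1 ∷ map suc (from1 n)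
from1-suc n = cong (λ z → 1 ∷ map suc z) (sym (map-applyUpTo (λ x → x) suc n))

from1-snoc : ∀ n → from1 (suc n) ≡ from1 n ++ (suc n ∷ [])
from1-snoc n = trans (cong (map suc) (sym (upTo-∷ʳ n))) (map-++ suc (upTo n) (n ∷ []))

length-from1 : ∀ n → length (from1 n) ≡ n
length-from1 n = trans (length-map suc (upTo n)) (length-upTo n)

map-from1-suc : ∀ {A : Set} (f : ℕ → A) n → map f (from1 (suc n)) ≡ f 1 ∷ map (f ∘ suc) (from1 n)
map-from1-suc f n = trans (cong (map f) (from1-suc n)) (cong (f 1 ∷_) (sym (map-∘ (from1 n))))

map-from1-snoc : ∀ {A : Set} (f : ℕ → A) n → map f (from1 (suc n)) ≡ map f (from1 n) ++ (f (suc n) ∷ [])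
map-from1-snoc f n = trans (cong (map f) (from1-snoc n)) (map-++ f (from1 n) (suc n ∷ []))

countᵇ-from1-snoc : ∀ (p : ℕ → Bool) n → countᵇ p (from1 (suc n)) ≡ countᵇ p (from1 n) + 𝟙 (p (suc n))
countᵇ-from1-snoc p n = begin
  countᵇ p (from1 (suc n))                         ≡⟨ cong (countᵇ p) (from1-snoc n) ⟩
  countᵇ p (from1 n ++ (suc n ∷ []))              ≡⟨ countᵇ-++ p (from1 n) (suc n ∷ []) ⟩
  countᵇ p (from1 n) + (𝟙 (p (suc n)) + 0)        ≡⟨ cong (countᵇ p (from1 n) +_) (+-identityʳ _) ⟩
  countᵇ p (from1 n) + 𝟙 (p (suc n))              ∎
  where open ≡-Reasoning

sum-from1-snoc : ∀ (f : ℕ → ℕ) n → sum (map f (from1 (suc n))) ≡ sum (map f (from1 n)) + f (suc n)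
sum-from1-snoc f n = begin
  sum (map f (from1 (suc n)))                      ≡⟨ cong sum (map-from1-snoc f n) ⟩
  sum (map f (from1 n) ++ (f (suc n) ∷ []))       ≡⟨ sum-++ (map f (from1 n)) (f (suc n) ∷ []) ⟩
  sum (map f (from1 n)) + (f (suc n) + 0)          ≡⟨ cong (sum (map f (from1 n)) +_) (+-identityʳ _) ⟩
  sum (map f (from1 n)) + f (suc n)                ∎
  where open ≡-Reasoning

map-cong-from1 : ∀ {A : Set} {f g : ℕ → A} n → (∀ c → 1 ≤ c → c ≤ n → f c ≡ g c) →
                 map f (from1 n) ≡ map g (from1 n)
map-cong-from1 zero _ = refl
map-cong-from1 {f = f} {g} (suc n) f≗g = begin
  map f (from1 (suc n))                   ≡⟨ map-from1-snoc f n ⟩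
  map f (from1 n) ++ (f (suc n) ∷ [])     ≡⟨ cong₂ _++_ (map-cong-from1 n (λ c a b → f≗g c a (m≤n⇒m≤1+n b)))
                                                        (cong (_∷ []) (f≗g (suc n) (s≤s z≤n) ≤-refl)) ⟩
  map g (from1 n) ++ (g (suc n) ∷ [])     ≡⟨ map-from1-snoc g n ⟨
  map g (from1 (suc n))                   ∎
  where open ≡-Reasoning

countᵇ≡sum : ∀ {A : Set} (p : A → Bool) xs → countᵇ p xs ≡ sum (map (𝟙 ∘ p) xs)
countᵇ≡sum p []       = refl
countᵇ≡sum p (x ∷ xs) = cong (𝟙 (p x) +_) (countᵇ≡sum p xs)

countᵇ-cong-from1 : ∀ {p q : ℕ → Bool} n → (∀ c → 1 ≤ c → c ≤ n → p c ≡ q c) →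
                    countᵇ p (from1 n) ≡ countᵇ q (from1 n)
countᵇ-cong-from1 {p} {q} n p≗q = begin
  countᵇ p (from1 n)            ≡⟨ countᵇ≡sum p (from1 n) ⟩
  sum (map (𝟙 ∘ p) (from1 n))   ≡⟨ cong sum (map-cong-from1 n (λ c 1≤c c≤n → cong 𝟙 (p≗q c 1≤c c≤n))) ⟩
  sum (map (𝟙 ∘ q) (from1 n))   ≡⟨ countᵇ≡sum q (from1 n) ⟨
  countᵇ q (from1 n)            ∎
  where open ≡-Reasoning

countᵇ-from1-true : ∀ (p : ℕ → Bool) n → (∀ c → 1 ≤ c → c ≤ n → p c ≡ true) → countᵇ p (from1 n) ≡ n
countᵇ-from1-true p zero    _ = refl
countᵇ-from1-true p (suc n) p≡true = begin
  countᵇ p (from1 (suc n))            ≡⟨ countᵇ-from1-snoc p n ⟩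
  countᵇ p (from1 n) + 𝟙 (p (suc n))  ≡⟨ cong₂ _+_ (countᵇ-from1-true p n (λ c a b → p≡true c a (m≤n⇒m≤1+n b)))
                                                    (cong 𝟙 (p≡true (suc n) (s≤s z≤n) ≤-refl)) ⟩
  n + 1                               ≡⟨ +-comm n 1 ⟩
  suc n                               ∎
  where open ≡-Reasoning

sum-from1-extend : ∀ (f : ℕ → ℕ) K d → (∀ c → K < c → f c ≡ 0) →
                   sum (map f (from1 (d + K))) ≡ sum (map f (from1 K))
sum-from1-extend f K zero    _   = refl
sum-from1-extend f K (suc d) f≡0 = begin
  sum (map f (from1 (suc (d + K))))             ≡⟨ sum-from1-snoc f (d + K) ⟩
  sum (map f (from1 (d + K))) + f (suc (d + K)) ≡⟨ cong (sum (map f (from1 (d + K))) +_) (f≡0 _ (s≤s (m≤n+m K d))) ⟩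
  sum (map f (from1 (d + K))) + 0               ≡⟨ +-identityʳ _ ⟩
  sum (map f (from1 (d + K)))                   ≡⟨ sum-from1-extend f K d f≡0 ⟩
  sum (map f (from1 K))                         ∎
  where open ≡-Reasoning

sum-from1-stable : ∀ (f : ℕ → ℕ) L₁ L₂ → (∀ c → L₁ < c → f c ≡ 0) → (∀ c → L₂ < c → f c ≡ 0) →
                   sum (map f (from1 L₁)) ≡ sum (map f (from1 L₂))
sum-from1-stable f L₁ L₂ f≡0₁ f≡0₂ with ≤-total L₁ L₂
... | inj₁ L₁≤L₂ =
  sym (trans (cong (λ L → sum (map f (from1 L))) (sym (m∸n+n≡m L₁≤L₂))) (sum-from1-extend f L₁ (L₂ ∸ L₁) f≡0₁))
... | inj₂ L₂≤L₁ =
  trans (cong (λ L → sum (map f (from1 L))) (sym (m∸n+n≡m L₂≤L₁))) (sum-from1-extend f L₂ (L₁ ∸ L₂) f≡0₂)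

countᵇ-from1-stable : ∀ (p : ℕ → Bool) L₁ L₂ → (∀ c → L₁ < c → p c ≡ false) → (∀ c → L₂ < c → p c ≡ false) →
                      countᵇ p (from1 L₁) ≡ countᵇ p (from1 L₂)
countᵇ-from1-stable p L₁ L₂ p≡false₁ p≡false₂ = begin
  countᵇ p (from1 L₁)             ≡⟨ countᵇ≡sum p (from1 L₁) ⟩
  sum (map (𝟙 ∘ p) (from1 L₁))    ≡⟨ sum-from1-stable (𝟙 ∘ p) L₁ L₂ (λ c lt → cong 𝟙 (p≡false₁ c lt))
                                                                    (λ c lt → cong 𝟙 (p≡false₂ c lt)) ⟩
  sum (map (𝟙 ∘ p) (from1 L₂))    ≡⟨ countᵇ≡sum p (from1 L₂) ⟨
  countᵇ p (from1 L₂)             ∎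
  where open ≡-Reasoning

f≤sum-from1 : ∀ (f : ℕ → ℕ) n c → 1 ≤ c → c ≤ n → f c ≤ sum (map f (from1 n))
f≤sum-from1 f zero    c 1≤c c≤0 = ⊥-elim (<⇒≱ 1≤c c≤0)
f≤sum-from1 f (suc n) c 1≤c c≤n rewrite sum-from1-snoc f n with m≤n⇒m<n∨m≡n c≤n
... | inj₁ c<n  = ≤-trans (f≤sum-from1 f n c 1≤c (≤-pred c<n)) (m≤m+n _ _)
... | inj₂ refl = m≤n+m _ _

f+f≤sum-from1 : ∀ (f : ℕ → ℕ) n c c' → 1 ≤ c → c < c' → c' ≤ n → f c + f c' ≤ sum (map f (from1 n))
f+f≤sum-from1 f zero    c c' 1≤c c<c' c'≤0 = ⊥-elim (<⇒≱ (≤-trans 1≤c (<⇒≤ c<c')) c'≤0)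
f+f≤sum-from1 f (suc n) c c' 1≤c c<c' c'≤n rewrite sum-from1-snoc f n with m≤n⇒m<n∨m≡n c'≤n
... | inj₁ c'<n = ≤-trans (f+f≤sum-from1 f n c c' 1≤c c<c' (≤-pred c'<n)) (m≤m+n _ _)
... | inj₂ refl = +-monoˡ-≤ (f (suc n)) (f≤sum-from1 f n c 1≤c (≤-pred c<c'))

1≤countᵇ-from1 : ∀ (p : ℕ → Bool) n c → 1 ≤ c → c ≤ n → p c ≡ true → 1 ≤ countᵇ p (from1 n)
1≤countᵇ-from1 p n c 1≤c c≤n pc = begin
  1                             ≡⟨ cong 𝟙 pc ⟨
  𝟙 (p c)                       ≤⟨ f≤sum-from1 (𝟙 ∘ p) n c 1≤c c≤n ⟩
  sum (map (𝟙 ∘ p) (from1 n))   ≡⟨ countᵇ≡sum p (from1 n) ⟨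
  countᵇ p (from1 n)            ∎
  where open ≤-Reasoning

Decreasing : List ℕ → Set
Decreasing = Linked _≥_

part-beyond-length : ∀ xs c → length xs < c → part xs c ≡ 0
part-beyond-length []       zero          _         = refl
part-beyond-length []       (suc c)       _         = refl
part-beyond-length (x ∷ xs) (suc (suc c)) (s≤s len<c) = part-beyond-length xs (suc c) len<c

part-positive : ∀ {xs} → All (1 ≤_) xs → ∀ c → 1 ≤ c → c ≤ length xs → 1 ≤ part xs c
part-positive (p ∷ _)  (suc zero)    _ _           = p
part-positive (_ ∷ ps) (suc (suc c)) _ (s≤s c≤len) = part-positive ps (suc c) (s≤s z≤n) c≤len

1≤part⇒≤length : ∀ xs c → 1 ≤ part xs c → c ≤ length xs
1≤part⇒≤length xs c 1≤part with length xs <? c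
... | yes len<c rewrite part-beyond-length xs c len<c = ⊥-elim (<⇒≱ 1≤part z≤n)
... | no len≮c = ≮⇒≥ len≮c

part≤head : ∀ {x xs} → Decreasing (x ∷ xs) → ∀ c → part xs c ≤ x
part≤head {xs = []}    _        zero          = z≤n
part≤head {xs = []}    _        (suc c)       = z≤n
part≤head {xs = _ ∷ _} _        zero          = z≤n
part≤head {xs = _ ∷ _} (x≥y ∷ _)  (suc zero)    = x≥y
part≤head {xs = _ ∷ _} (x≥y ∷ ys) (suc (suc c)) = ≤-trans (part≤head ys (suc c)) x≥y

part-antitone : ∀ {xs} → Decreasing xs → ∀ c c' → 1 ≤ c → c ≤ c' → part xs c' ≤ part xs c
part-antitone {[]}    _  c             zero           _ _ = z≤n
part-antitone {[]}    _  c             (suc c')       _ _ = z≤n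
part-antitone {_ ∷ _} _  (suc zero)    (suc zero)     _ _ = ≤-refl
part-antitone {_ ∷ _} xs (suc zero)    (suc (suc c')) _ _ = part≤head xs (suc c')
part-antitone {_ ∷ _} xs (suc (suc c)) (suc (suc c')) _ (s≤s c≤c') =
  part-antitone (Linked-tail xs) (suc c) (suc c') (s≤s z≤n) c≤c'

part≤maxL : ∀ xs c → part xs c ≤ maxL xs
part≤maxL []       zero          = z≤n
part≤maxL []       (suc c)       = z≤n
part≤maxL (x ∷ xs) zero          = z≤n
part≤maxL (x ∷ xs) (suc zero)    = m≤m⊔n x (maxL xs)
part≤maxL (x ∷ xs) (suc (suc c)) = ≤-trans (part≤maxL xs (suc c)) (m≤n⊔m x (maxL xs))

part-map-from1 : ∀ (f : ℕ → ℕ) n c → 1 ≤ c → c ≤ n → part (map f (from1 n)) c ≡ f c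
part-map-from1 f zero    c 1≤c c≤0 = ⊥-elim (<⇒≱ 1≤c c≤0)
part-map-from1 f (suc n) c 1≤c c≤n rewrite map-from1-suc f n with c | c≤n
... | suc zero     | _           = refl
... | suc (suc c') | s≤s c'<n    = part-map-from1 (f ∘ suc) n (suc c') (s≤s z≤n) c'<n

part-map-from1-beyond : ∀ (f : ℕ → ℕ) n c → n < c → part (map f (from1 n)) c ≡ 0
part-map-from1-beyond f n c n<c =
  part-beyond-length (map f (from1 n)) c (subst (_< c) (sym (trans (length-map f (from1 n)) (length-from1 n))) n<c)

map-part-from1 : ∀ xs → map (part xs) (from1 (length xs)) ≡ xs
map-part-from1 []       = refl
map-part-from1 (x ∷ xs) = trans (map-from1-suc (part (x ∷ xs)) (length xs))
  (cong (x ∷_) (trans (map-cong-from1 (length xs) (λ { (suc c) _ _ → refl })) (map-part-from1 xs)))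

countᵇ-part-from1 : ∀ (q : ℕ → Bool) xs → countᵇ (q ∘ part xs) (from1 (length xs)) ≡ countᵇ q xs
countᵇ-part-from1 q xs =
  trans (sym (countᵇ-map q (part xs) (from1 (length xs)))) (cong (countᵇ q) (map-part-from1 xs))

countᵇ-1≤ᵇ : ∀ {xs} → All (1 ≤_) xs → countᵇ (1 ≤ᵇ_) xs ≡ length xs
countᵇ-1≤ᵇ []                    = refl
countᵇ-1≤ᵇ {suc _ ∷ _} (_ ∷ ps) = cong suc (countᵇ-1≤ᵇ ps)

countᵇ-≤ᵇ-above-maxL : ∀ xs c → maxL xs < c → countᵇ (c ≤ᵇ_) xs ≡ 0
countᵇ-≤ᵇ-above-maxL []       c _ = refl
countᵇ-≤ᵇ-above-maxL (x ∷ xs) c max<c rewrite >⇒≤ᵇ≡false {c} {x} (m⊔n<o⇒m<o x (maxL xs) max<c) =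
  countᵇ-≤ᵇ-above-maxL xs c (m⊔n<o⇒n<o x (maxL xs) max<c)

part-conj : ∀ xs c → 1 ≤ c → part (conj xs) c ≡ countᵇ (c ≤ᵇ_) xs
part-conj xs c 1≤c with c ≤? maxL xs
... | yes c≤max = part-map-from1 (λ i → countᵇ (i ≤ᵇ_) xs) (maxL xs) c 1≤c c≤max
... | no c≰max  = trans (part-map-from1-beyond _ (maxL xs) c (≰⇒> c≰max))
                        (sym (countᵇ-≤ᵇ-above-maxL xs c (≰⇒> c≰max)))

countᵇ-≤ᵇ-above-head : ∀ {x xs} i → Decreasing (x ∷ xs) → x < i → countᵇ (i ≤ᵇ_) (x ∷ xs) ≡ 0
countᵇ-≤ᵇ-above-head {x} {[]}    i _          x<i rewrite >⇒≤ᵇ≡false {i} {x} x<i = refl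
countᵇ-≤ᵇ-above-head {x} {_ ∷ _} i (x≥y ∷ ys) x<i rewrite >⇒≤ᵇ≡false {i} {x} x<i =
  countᵇ-≤ᵇ-above-head i ys (≤-<-trans x≥y x<i)

≤-part⇒≤-countᵇ : ∀ {xs} → Decreasing xs → ∀ c i → 1 ≤ c → 1 ≤ i → i ≤ part xs c → c ≤ countᵇ (i ≤ᵇ_) xs
≤-part⇒≤-countᵇ {[]}     _  (suc c) i _ 1≤i i≤0 = ⊥-elim (<⇒≱ 1≤i i≤0)
≤-part⇒≤-countᵇ {x ∷ xs} _  (suc zero) i _ _ i≤x rewrite ≤⇒≤ᵇ≡true {i} {x} i≤x = s≤s z≤n
≤-part⇒≤-countᵇ {x ∷ xs} xs↓ (suc (suc c)) i _ 1≤i i≤part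
  rewrite ≤⇒≤ᵇ≡true {i} {x} (≤-trans i≤part (part≤head xs↓ (suc c))) =
  s≤s (≤-part⇒≤-countᵇ (Linked-tail xs↓) (suc c) i (s≤s z≤n) 1≤i i≤part)

≤-countᵇ⇒≤-part : ∀ {xs} → Decreasing xs → ∀ c i → 1 ≤ c → c ≤ countᵇ (i ≤ᵇ_) xs → i ≤ part xs c
≤-countᵇ⇒≤-part {[]}     _   (suc c) i _ ()
≤-countᵇ⇒≤-part {x ∷ xs} xs↓ c i 1≤c c≤count with i ≤? x
≤-countᵇ⇒≤-part {x ∷ xs} xs↓ (suc zero)    i _ _       | yes i≤x = i≤x
≤-countᵇ⇒≤-part {x ∷ xs} xs↓ (suc (suc c)) i _ c≤count | yes i≤x rewrite ≤⇒≤ᵇ≡true {i} {x} i≤x =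
  ≤-countᵇ⇒≤-part (Linked-tail xs↓) (suc c) i (s≤s z≤n) (≤-pred c≤count)
≤-countᵇ⇒≤-part {x ∷ xs} xs↓ c i 1≤c c≤count | no i≰x
  rewrite countᵇ-≤ᵇ-above-head i xs↓ (≰⇒> i≰x) = ⊥-elim (<⇒≱ 1≤c c≤count)

countᵇ-≤ᵇ-from1 : ∀ v n → v ≤ n → countᵇ (_≤ᵇ v) (from1 n) ≡ v
countᵇ-≤ᵇ-from1 zero    zero    _   = refl
countᵇ-≤ᵇ-from1 v       (suc n) v≤n with m≤n⇒m<n∨m≡n v≤n
... | inj₁ v<1+n = begin
  countᵇ (_≤ᵇ v) (from1 (suc n))               ≡⟨ countᵇ-from1-snoc _ n ⟩
  countᵇ (_≤ᵇ v) (from1 n) + 𝟙 (suc n ≤ᵇ v)    ≡⟨ cong₂ _+_ (countᵇ-≤ᵇ-from1 v n (≤-pred v<1+n)) (cong 𝟙 (>⇒≤ᵇ≡false v<1+n)) ⟩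
  v + 0                                        ≡⟨ +-identityʳ v ⟩
  v                                            ∎
  where open ≡-Reasoning
... | inj₂ refl = countᵇ-from1-true _ (suc n) (λ c _ c≤1+n → ≤⇒≤ᵇ≡true c≤1+n)

countᵇ-conj : ∀ {xs} → Decreasing xs → ∀ c → 1 ≤ c → countᵇ (c ≤ᵇ_) (conj xs) ≡ part xs c
countᵇ-conj {xs} xs↓ c 1≤c = begin
  countᵇ (c ≤ᵇ_) (conj xs)                                       ≡⟨ countᵇ-map (c ≤ᵇ_) _ (from1 (maxL xs)) ⟩
  countᵇ (λ i → c ≤ᵇ countᵇ (i ≤ᵇ_) xs) (from1 (maxL xs))        ≡⟨ countᵇ-cong-from1 (maxL xs) (λ i 1≤i _ →
                                                                     ≤ᵇ-cong-⇔ (≤-countᵇ⇒≤-part xs↓ c i 1≤c)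
                                                                               (≤-part⇒≤-countᵇ xs↓ c i 1≤c 1≤i)) ⟩
  countᵇ (_≤ᵇ part xs c) (from1 (maxL xs))                       ≡⟨ countᵇ-≤ᵇ-from1 (part xs c) (maxL xs) (part≤maxL xs c) ⟩
  part xs c                                                      ∎
  where open ≡-Reasoning

part-decAt-≢ : ∀ xs c c' → c' ≢ c → part (decAt c xs) c' ≡ part xs c'
part-decAt-≢ xs       zero          c'             _    = refl
part-decAt-≢ []       (suc c)       c'             _    = refl
part-decAt-≢ (x ∷ xs) (suc zero)    zero           _    = refl
part-decAt-≢ (x ∷ xs) (suc zero)    (suc zero)     c'≢c = ⊥-elim (c'≢c refl)
part-decAt-≢ (x ∷ xs) (suc zero)    (suc (suc c')) _    = refl
part-decAt-≢ (x ∷ xs) (suc (suc c)) zero           _    = refl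
part-decAt-≢ (x ∷ xs) (suc (suc c)) (suc zero)     _    = refl
part-decAt-≢ (x ∷ xs) (suc (suc c)) (suc (suc c')) c'≢c = part-decAt-≢ xs (suc c) (suc c') (c'≢c ∘ cong suc)

part-decAt-≡ : ∀ xs c → part (decAt c xs) c ≡ part xs c ∸ 1
part-decAt-≡ xs       zero          = refl
part-decAt-≡ []       (suc c)       = refl
part-decAt-≡ (x ∷ xs) (suc zero)    = refl
part-decAt-≡ (x ∷ xs) (suc (suc c)) = part-decAt-≡ xs (suc c)

part-decAt-≤ : ∀ xs c c' → part (decAt c xs) c' ≤ part xs c'
part-decAt-≤ xs c c' with c' ≟ c
... | yes refl rewrite part-decAt-≡ xs c = m∸n≤m _ 1
... | no c'≢c rewrite part-decAt-≢ xs c c' c'≢c = ≤-refl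

part-decAt : ∀ xs c₀ c → 1 ≤ part xs c₀ → part (decAt c₀ xs) c + 𝟙 (c ≡ᵇ c₀) ≡ part xs c
part-decAt xs c₀ c 1≤part with c ≟ c₀
... | yes refl rewrite part-decAt-≡ xs c | ≡ᵇ-refl c = m∸n+n≡m 1≤part
... | no c≢c₀ rewrite part-decAt-≢ xs c₀ c c≢c₀ | ≢⇒≡ᵇ≡false c≢c₀ = +-identityʳ _

length-decAt : ∀ xs c → length (decAt c xs) ≡ length xs
length-decAt xs       zero          = refl
length-decAt []       (suc c)       = refl
length-decAt (x ∷ xs) (suc zero)    = refl
length-decAt (x ∷ xs) (suc (suc c)) = cong suc (length-decAt xs (suc c))

decAt-beyond-length : ∀ xs c → length xs < c → decAt c xs ≡ xs
decAt-beyond-length []       (suc c)       _           = refl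
decAt-beyond-length (x ∷ xs) (suc (suc c)) (s≤s len<c) = cong (x ∷_) (decAt-beyond-length xs (suc c) len<c)

size-decAt : ∀ xs c → size xs ≤ suc (size (decAt c xs))
size-decAt xs           zero          = n≤1+n _
size-decAt []           (suc c)       = z≤n
size-decAt (zero ∷ xs)  (suc zero)    = n≤1+n _
size-decAt (suc x ∷ xs) (suc zero)    = ≤-refl
size-decAt (x ∷ xs)     (suc (suc c)) =
  subst (x + size xs ≤_) (+-suc x (size (decAt (suc c) xs))) (+-monoʳ-≤ x (size-decAt xs (suc c)))

𝟙-≤ᵇ-pred : ∀ c x → 1 ≤ c → 𝟙 (c ≤ᵇ x ∸ 1) + 𝟙 (c ≡ᵇ x) ≡ 𝟙 (c ≤ᵇ x)
𝟙-≤ᵇ-pred (suc c) zero    _ = refl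
𝟙-≤ᵇ-pred (suc c) (suc x) _ = go c x
  where
  go : ∀ c x → 𝟙 (c <ᵇ x) + 𝟙 (c ≡ᵇ x) ≡ 𝟙 (c <ᵇ suc x)
  go zero    zero    = refl
  go zero    (suc x) = refl
  go (suc c) zero    = refl
  go (suc c) (suc x) = go c x

countᵇ-≤ᵇ-decAt : ∀ xs c j → 1 ≤ c → 1 ≤ j →
                  countᵇ (c ≤ᵇ_) (decAt j xs) + 𝟙 (c ≡ᵇ part xs j) ≡ countᵇ (c ≤ᵇ_) xs
countᵇ-≤ᵇ-decAt []       (suc c) (suc j)       _   _ = refl
countᵇ-≤ᵇ-decAt (x ∷ xs) c       (suc zero)    1≤c _ = begin
  (a + R) + b  ≡⟨ +-assoc a R b ⟩
  a + (R + b)  ≡⟨ cong (a +_) (+-comm R b) ⟩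
  a + (b + R)  ≡⟨ +-assoc a b R ⟨
  (a + b) + R  ≡⟨ cong (_+ R) (𝟙-≤ᵇ-pred c x 1≤c) ⟩
  𝟙 (c ≤ᵇ x) + R ∎
  where
  open ≡-Reasoning
  a b R : ℕ
  a = 𝟙 (c ≤ᵇ x ∸ 1)
  b = 𝟙 (c ≡ᵇ x)
  R = countᵇ (c ≤ᵇ_) xs
countᵇ-≤ᵇ-decAt (x ∷ xs) c (suc (suc j)) 1≤c _ =
  trans (+-assoc (𝟙 (c ≤ᵇ x)) _ _) (cong (𝟙 (c ≤ᵇ x) +_) (countᵇ-≤ᵇ-decAt xs c (suc j) 1≤c (s≤s z≤n)))

-- λ^(j+1) is λ with the bottom box of column λ'_(j+1) removed.
part-lamj : ∀ {lam} → Decreasing lam → ∀ j c → 1 ≤ c →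
            part (lamj lam (suc j)) c + 𝟙 (c ≡ᵇ part (conj lam) (suc j)) ≡ part lam c
part-lamj {lam} lam↓ j c 1≤c = begin
  part (conj μ') c + b                       ≡⟨ cong (_+ b) (part-conj μ' c 1≤c) ⟩
  countᵇ (c ≤ᵇ_) μ' + b                      ≡⟨ countᵇ-≤ᵇ-decAt (conj lam) c (suc j) 1≤c (s≤s z≤n) ⟩
  countᵇ (c ≤ᵇ_) (conj lam)                  ≡⟨ countᵇ-conj lam↓ c 1≤c ⟩
  part lam c                                 ∎
  where
  open ≡-Reasoning
  μ' : List ℕ
  μ' = decAt (suc j) (conj lam)
  b : ℕ
  b = 𝟙 (c ≡ᵇ part (conj lam) (suc j))

∸≡suc-∸suc : ∀ p r → suc r ≤ p → p ∸ r ≡ suc (p ∸ suc r)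
∸≡suc-∸suc (suc p) zero    _         = refl
∸≡suc-∸suc (suc p) (suc r) (s≤s r<p) = ∸≡suc-∸suc p r r<p

≤∸1⇒< : ∀ {r} p → 1 ≤ r → r ≤ p ∸ 1 → r < p
≤∸1⇒< zero    1≤r r≤0 = ⊥-elim (<⇒≱ 1≤r r≤0)
≤∸1⇒< (suc p) _   r≤p = s≤s r≤p

isBig : ∀ {m} → Maybe (Fin m) → Fin m → Bool
isBig nothing  i = true
isBig (just k) i = toℕ i <ᵇ toℕ k

bigᵇ≡isBig : ∀ {m} (μ : List ℕ) (σ : Fin m → ℕ) r c i → bigᵇ μ σ r c i ≡ isBig (content μ σ r c) i
bigᵇ≡isBig μ σ r c i with content μ σ r c
... | nothing = refl
... | just k  = refl

isBig-map-suc : ∀ {m} (x : Maybe (Fin m)) i → isBig (mapₘ suc x) (suc i) ≡ isBig x i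
isBig-map-suc nothing  i = refl
isBig-map-suc (just k) i = refl

is-nothing-map-suc : ∀ {m} (x : Maybe (Fin m)) → is-nothing (mapₘ (Fin.suc {m}) x) ≡ is-nothing x
is-nothing-map-suc nothing  = refl
is-nothing-map-suc (just k) = refl

content-column : ∀ {m} (μ : List ℕ) (σ : Fin m → ℕ) r c {k} → content μ σ r c ≡ just k → σ k ≡ c
content-column {m} μ σ r c e = ≡ᵇ≡true⇒≡ (∧≡true⇒ˡ (firstᵇ-sound _ (allFin m) e))

bigᵇ-zero : ∀ {m} μ (σ : Fin (suc m) → ℕ) r c → c ≢ σ zero → bigᵇ μ σ r c zero ≡ true
bigᵇ-zero μ σ r c c≢σ₀ rewrite bigᵇ≡isBig μ σ r c zero with content μ σ r c in e
... | nothing      = refl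
... | just zero    = ⊥-elim (c≢σ₀ (sym (content-column μ σ r c e)))
... | just (suc k) = refl

RowsDecrease : ∀ {m} → List ℕ → (Fin m → ℕ) → Set
RowsDecrease μ σ = ∀ r c c' k k' → 1 ≤ r → r ≤ part μ c → r ≤ part μ c' → c < c' →
                   content μ σ r c ≡ just k → content μ σ r c' ≡ just k' → toℕ k' < toℕ k

emptyIn : ∀ {m} → List ℕ → (Fin m → ℕ) → ℕ → ℕ
emptyIn μ σ c = countᵇ (λ r → is-nothing (content μ σ r c)) (from1 (part μ c))

-- The number 1 is the lowest entry of its column σ 0, so deleting it leaves a diagram
-- of μ⁻ (that column shortened by one box) holding 2, …, m.

module Peel {m : ℕ} (μ : List ℕ) (σ : Fin (suc m) → ℕ) where

  μ⁻ : List ℕ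
  μ⁻ = decAt (σ zero) μ

  σ⁻ : Fin m → ℕ
  σ⁻ = σ ∘ suc

  rank-zero : rank μ σ zero ≡ 0
  rank-zero = countᵇ-false _ (λ _ → ∧-zeroʳ _) (allFin (suc m))

  rank-suc : ∀ k → rank μ σ (suc k) ≡ 𝟙 (σ zero ≡ᵇ σ (suc k)) + rank μ⁻ σ⁻ k
  rank-suc k = trans (cong (countᵇ _) (allFin-suc m))
    (cong₂ _+_ (cong 𝟙 (∧-identityʳ _)) (countᵇ-map _ suc (allFin m)))

  rank-suc-≡ : ∀ k → σ (suc k) ≡ σ zero → rank μ σ (suc k) ≡ suc (rank μ⁻ σ⁻ k)
  rank-suc-≡ k e = trans (rank-suc k) (cong (λ b → 𝟙 b + rank μ⁻ σ⁻ k) (trans (cong (σ zero ≡ᵇ_) e) (≡ᵇ-refl (σ zero))))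

  rank-suc-≢ : ∀ k → σ (suc k) ≢ σ zero → rank μ σ (suc k) ≡ rank μ⁻ σ⁻ k
  rank-suc-≢ k ne = trans (rank-suc k) (cong (λ b → 𝟙 b + rank μ⁻ σ⁻ k) (≢⇒≡ᵇ≡false (ne ∘ sym)))

  part-μ⁻-σ₀ : part μ⁻ (σ zero) ≡ part μ (σ zero) ∸ 1
  part-μ⁻-σ₀ = part-decAt-≡ μ (σ zero)

  inBoxᵇ-suc : ∀ k → inBoxᵇ μ σ (suc k) ≡ inBoxᵇ μ⁻ σ⁻ k
  inBoxᵇ-suc k with σ (suc k) ≟ σ zero
  ... | yes e = trans (cong₂ (λ R s → R <ᵇ part μ s) (rank-suc-≡ k e) e)
                      (trans (suc<ᵇ (part μ (σ zero))) (cong (R <ᵇ_) (sym (trans (cong (part μ⁻) e) part-μ⁻-σ₀))))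
    where
    R : ℕ
    R = rank μ⁻ σ⁻ k
    suc<ᵇ : ∀ p → (suc R <ᵇ p) ≡ (R <ᵇ p ∸ 1)
    suc<ᵇ zero    = refl
    suc<ᵇ (suc p) = refl
  ... | no ne rewrite rank-suc-≢ k ne | part-decAt-≢ μ (σ zero) (σ (suc k)) ne = refl

  rowOf-suc : ∀ k → rowOf μ σ (suc k) ≡ rowOf μ⁻ σ⁻ k
  rowOf-suc k with σ (suc k) ≟ σ zero
  ... | yes e = trans (cong₂ (λ R s → part μ s ∸ R) (rank-suc-≡ k e) e)
                      (trans (sym (∸-+-assoc (part μ (σ zero)) 1 R)) (cong (_∸ R) (sym (trans (cong (part μ⁻) e) part-μ⁻-σ₀))))
    where
    R : ℕ
    R = rank μ⁻ σ⁻ k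
  ... | no ne rewrite rank-suc-≢ k ne | part-decAt-≢ μ (σ zero) (σ (suc k)) ne = refl

  content-suc : ∀ r c → 1 ≤ r → r ≤ part μ⁻ c → content μ σ r c ≡ mapₘ suc (content μ⁻ σ⁻ r c)
  content-suc r c 1≤r r≤part = begin
    firstᵇ p (allFin (suc m))              ≡⟨ cong (firstᵇ p) (allFin-suc m) ⟩
    firstᵇ p (zero ∷ map suc (allFin m))   ≡⟨ firstᵇ-head-false p zero (map suc (allFin m)) zero-not-there ⟩
    firstᵇ p (map suc (allFin m))          ≡⟨ firstᵇ-map p suc (allFin m) ⟩
    mapₘ suc (firstᵇ (p ∘ suc) (allFin m)) ≡⟨ cong (mapₘ suc) (firstᵇ-cong p-suc (allFin m)) ⟩
    mapₘ suc (content μ⁻ σ⁻ r c)           ∎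
    where
    open ≡-Reasoning
    p : Fin (suc m) → Bool
    p k = (σ k ≡ᵇ c) ∧ (rank μ σ k ≡ᵇ (part μ c ∸ r))
    r<part : c ≡ σ zero → r < part μ (σ zero)
    r<part refl = ≤∸1⇒< (part μ (σ zero)) 1≤r (subst (r ≤_) part-μ⁻-σ₀ r≤part)
    zero-not-there : p zero ≡ false
    zero-not-there with σ zero ≟ c
    ... | no ne rewrite ≢⇒≡ᵇ≡false ne = refl
    ... | yes refl = trans (cong₂ (λ x y → x ∧ (y ≡ᵇ (part μ (σ zero) ∸ r))) (≡ᵇ-refl (σ zero)) rank-zero)
                           (≢⇒≡ᵇ≡false (m>n⇒m∸n≢0 (r<part refl) ∘ sym))
    rank-row : ∀ {k} → σ (suc k) ≡ c → (rank μ σ (suc k) ≡ᵇ (part μ c ∸ r)) ≡ (rank μ⁻ σ⁻ k ≡ᵇ (part μ⁻ c ∸ r))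
    rank-row {k} e with c ≟ σ zero
    ... | yes refl = trans (cong₂ _≡ᵇ_ (rank-suc-≡ k e) (∸≡suc-∸suc (part μ c) r (r<part refl)))
                           (cong (rank μ⁻ σ⁻ k ≡ᵇ_) (sym (trans (cong (_∸ r) part-μ⁻-σ₀) (∸-+-assoc (part μ c) 1 r))))
    ... | no ne rewrite rank-suc-≢ k (ne ∘ trans (sym e)) | part-decAt-≢ μ (σ zero) c ne = refl
    p-suc : ∀ k → p (suc k) ≡ ((σ⁻ k ≡ᵇ c) ∧ (rank μ⁻ σ⁻ k ≡ᵇ (part μ⁻ c ∸ r)))
    p-suc k = ∧-congˡ-guarded (σ (suc k) ≡ᵇ c) (rank-row ∘ ≡ᵇ≡true⇒≡)

  content-σ₀ : content μ σ (part μ (σ zero)) (σ zero) ≡ just zero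
  content-σ₀ = trans (cong (firstᵇ _) (allFin-suc m)) (firstᵇ-head-true _ zero (map suc (allFin m)) zero-there)
    where
    zero-there : ((σ zero ≡ᵇ σ zero) ∧ (rank μ σ zero ≡ᵇ (part μ (σ zero) ∸ part μ (σ zero)))) ≡ true
    zero-there = trans (cong₂ (λ x y → x ∧ (y ≡ᵇ (part μ (σ zero) ∸ part μ (σ zero)))) (≡ᵇ-refl (σ zero)) rank-zero)
                       (cong (0 ≡ᵇ_) (n∸n≡0 (part μ (σ zero))))

  removed-box : ∀ r c → r ≤ part μ c → ¬ (r ≤ part μ⁻ c) → (c ≡ σ zero) × (r ≡ part μ (σ zero))
  removed-box r c r≤part r≰part⁻ with c ≟ σ zero
  ... | no ne rewrite part-decAt-≢ μ (σ zero) c ne = ⊥-elim (r≰part⁻ r≤part)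
  ... | yes refl rewrite part-decAt-≡ μ c = refl , ≤-antisym r≤part (pred<⇒≤ (part μ c) (≰⇒> r≰part⁻))
    where
    pred<⇒≤ : ∀ p → p ∸ 1 < r → p ≤ r
    pred<⇒≤ zero    _ = z≤n
    pred<⇒≤ (suc p) q = q

  bigᵇ-suc : ∀ r c i → 1 ≤ r →
             ((r ≤ᵇ part μ c) ∧ bigᵇ μ σ r c (suc i)) ≡ ((r ≤ᵇ part μ⁻ c) ∧ bigᵇ μ⁻ σ⁻ r c i)
  bigᵇ-suc r c i 1≤r with r ≤? part μ⁻ c
  ... | yes r≤part⁻ rewrite ≤⇒≤ᵇ≡true r≤part⁻ | ≤⇒≤ᵇ≡true (≤-trans r≤part⁻ (part-decAt-≤ μ (σ zero) c))
          | bigᵇ≡isBig μ σ r c (suc i) | bigᵇ≡isBig μ⁻ σ⁻ r c i | content-suc r c 1≤r r≤part⁻ =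
    isBig-map-suc (content μ⁻ σ⁻ r c) i
  ... | no r≰part⁻ rewrite >⇒≤ᵇ≡false (≰⇒> r≰part⁻) with r ≤? part μ c
  ...   | no r≰part rewrite >⇒≤ᵇ≡false (≰⇒> r≰part) = refl
  ...   | yes r≤part with removed-box r c r≤part r≰part⁻
  ...     | refl , refl rewrite ≤⇒≤ᵇ≡true r≤part | bigᵇ≡isBig μ σ (part μ (σ zero)) (σ zero) (suc i)
                              | content-σ₀ = refl

  countᵇ-row-suc : ∀ (g : ℕ → Bool) R i → 1 ≤ R →
    countᵇ (λ c → g c ∧ (R ≤ᵇ part μ c) ∧ bigᵇ μ σ R c (suc i)) (from1 (length μ)) ≡
    countᵇ (λ c → g c ∧ (R ≤ᵇ part μ⁻ c) ∧ bigᵇ μ⁻ σ⁻ R c i) (from1 (length μ⁻))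
  countᵇ-row-suc g R i 1≤R =
    trans (countᵇ-cong (λ c → cong (g c ∧_) (bigᵇ-suc R c i 1≤R)) (from1 (length μ)))
          (cong (λ L → countᵇ (λ c → g c ∧ (R ≤ᵇ part μ⁻ c) ∧ bigᵇ μ⁻ σ⁻ R c i) (from1 L))
                (sym (length-decAt μ (σ zero))))

  codeEntry-suc : ∀ i → codeEntry μ σ (suc i) ≡ codeEntry μ⁻ σ⁻ i
  codeEntry-suc i = if-cong (inBoxᵇ-suc i)
    (λ e → cong₂ _+_
      (trans (cong (λ R → countᵇ (λ c → (σ⁻ i <ᵇ c) ∧ (R ≤ᵇ part μ c) ∧ bigᵇ μ σ R c (suc i)) (cols μ σ)) (rowOf-suc i))
             (countᵇ-row-suc (σ⁻ i <ᵇ_) _ i (1≤row e)))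
      (trans (cong (λ R → countᵇ (λ c → (c <ᵇ σ⁻ i) ∧ (suc R ≤ᵇ part μ c) ∧ bigᵇ μ σ (suc R) c (suc i)) (cols μ σ)) (rowOf-suc i))
             (countᵇ-row-suc (_<ᵇ σ⁻ i) _ i (s≤s z≤n))))
    (λ _ → cong (σ⁻ i ∸ 1 +_) (countᵇ-row-suc (σ⁻ i <ᵇ_) 1 i (s≤s z≤n)))
    where
    1≤row : inBoxᵇ μ⁻ σ⁻ i ≡ true → 1 ≤ rowOf μ⁻ σ⁻ i
    1≤row e = m<n⇒0<n∸m (<ᵇ≡true⇒< {rank μ⁻ σ⁻ i} {part μ⁻ (σ⁻ i)} e)

  code-peel : code μ σ ≡ codeEntry μ σ zero ∷ code μ⁻ σ⁻
  code-peel = trans (cong (map (codeEntry μ σ)) (allFin-suc m))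
    (cong (codeEntry μ σ zero ∷_) (trans (sym (map-∘ (allFin m))) (map-cong codeEntry-suc (allFin m))))

  emptyIn-rows : ∀ c L → L ≤ part μ⁻ c →
                 countᵇ (λ r → is-nothing (content μ σ r c)) (from1 L) ≡
                 countᵇ (λ r → is-nothing (content μ⁻ σ⁻ r c)) (from1 L)
  emptyIn-rows c L L≤part = countᵇ-cong-from1 L λ r 1≤r r≤L →
    trans (cong is-nothing (content-suc r c 1≤r (≤-trans r≤L L≤part))) (is-nothing-map-suc (content μ⁻ σ⁻ r c))

  emptyIn-peel : ∀ c → emptyIn μ σ c ≡ emptyIn μ⁻ σ⁻ c
  emptyIn-peel c with c ≟ σ zero
  ... | no ne = trans (emptyIn-rows c (part μ c) (≤-reflexive (sym part≡)))
                      (cong (λ L → countᵇ (λ r → is-nothing (content μ⁻ σ⁻ r c)) (from1 L)) (sym part≡))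
    where
    part≡ : part μ⁻ c ≡ part μ c
    part≡ = part-decAt-≢ μ (σ zero) c ne
  ... | yes refl = column-σ₀ (part μ c) refl
    where
    empties⁻ : ℕ → ℕ
    empties⁻ L = countᵇ (λ r → is-nothing (content μ⁻ σ⁻ r c)) (from1 L)
    column-σ₀ : ∀ p → part μ c ≡ p → countᵇ (λ r → is-nothing (content μ σ r c)) (from1 p) ≡ emptyIn μ⁻ σ⁻ c
    column-σ₀ zero    e = cong empties⁻ (sym (trans part-μ⁻-σ₀ (cong (_∸ 1) e)))
    column-σ₀ (suc q) e = begin
      countᵇ (λ r → is-nothing (content μ σ r c)) (from1 (suc q))
        ≡⟨ countᵇ-from1-snoc _ q ⟩
      countᵇ (λ r → is-nothing (content μ σ r c)) (from1 q) + 𝟙 (is-nothing (content μ σ (suc q) c))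
        ≡⟨ cong₂ _+_ (emptyIn-rows c q (≤-reflexive (sym part⁻≡q)))
                     (cong (𝟙 ∘ is-nothing) (subst (λ p → content μ σ p c ≡ just zero) e content-σ₀)) ⟩
      empties⁻ q + 0
        ≡⟨ +-identityʳ _ ⟩
      empties⁻ q
        ≡⟨ cong empties⁻ part⁻≡q ⟨
      emptyIn μ⁻ σ⁻ c ∎
      where
      open ≡-Reasoning
      part⁻≡q : part μ⁻ c ≡ q
      part⁻≡q = trans part-μ⁻-σ₀ (cong (_∸ 1) e)

  emptyBoxes-peel : emptyBoxes μ σ ≡ emptyBoxes μ⁻ σ⁻
  emptyBoxes-peel = trans (cong sum (map-cong emptyIn-peel (from1 (length μ))))
                          (cong (λ L → sum (map (emptyIn μ⁻ σ⁻) (from1 L))) (sym (length-decAt μ (σ zero))))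

size≤emptyBoxes+m : ∀ m μ (σ : Fin m → ℕ) → size μ ≤ emptyBoxes μ σ + m
size≤emptyBoxes+m zero μ σ = ≤-reflexive (sym (begin
  emptyBoxes μ σ + 0                        ≡⟨ +-identityʳ _ ⟩
  sum (map (emptyIn μ σ) (from1 (length μ))) ≡⟨ cong sum (map-cong (λ c → countᵇ-from1-true _ (part μ c) (λ _ _ _ → refl))
                                                                 (from1 (length μ))) ⟩
  sum (map (part μ) (from1 (length μ)))      ≡⟨ cong sum (map-part-from1 μ) ⟩
  size μ                                     ∎))
  where open ≡-Reasoning
size≤emptyBoxes+m (suc m) μ σ = begin
  size μ                            ≤⟨ size-decAt μ (σ zero) ⟩
  suc (size μ⁻)                     ≤⟨ s≤s (size≤emptyBoxes+m m μ⁻ σ⁻) ⟩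
  suc (emptyBoxes μ⁻ σ⁻ + m)        ≡⟨ cong (λ e → suc (e + m)) emptyBoxes-peel ⟨
  suc (emptyBoxes μ σ + m)          ≡⟨ +-suc _ m ⟨
  emptyBoxes μ σ + suc m            ∎
  where
  open ≤-Reasoning
  open Peel μ σ

-- λ^(j) and λ with one box removed agree only partwise (the lists may differ by trailing
-- zeros), so diagrams are transported along partwise equality.

module PartwiseEqual {m : ℕ} (μ₁ μ₂ : List ℕ) (part≡ : ∀ c → part μ₁ c ≡ part μ₂ c) (σ : Fin m → ℕ) where

  content-≗ : ∀ r c → content μ₁ σ r c ≡ content μ₂ σ r c
  content-≗ r c = cong (λ p → firstᵇ (λ k → (σ k ≡ᵇ c) ∧ (rank μ₁ σ k ≡ᵇ (p ∸ r))) (allFin m)) (part≡ c)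

  bigᵇ-≗ : ∀ r c i → bigᵇ μ₁ σ r c i ≡ bigᵇ μ₂ σ r c i
  bigᵇ-≗ r c i = trans (bigᵇ≡isBig μ₁ σ r c i)
                       (trans (cong (λ x → isBig x i) (content-≗ r c)) (sym (bigᵇ≡isBig μ₂ σ r c i)))

  part₂-beyond : ∀ {c} → length μ₁ < c ⊎ length μ₂ < c → part μ₂ c ≡ 0
  part₂-beyond {c} (inj₁ len<c) = trans (sym (part≡ c)) (part-beyond-length μ₁ c len<c)
  part₂-beyond {c} (inj₂ len<c) = part-beyond-length μ₂ c len<c

  countᵇ-row-≗ : ∀ (g : ℕ → Bool) R i → 1 ≤ R →
    countᵇ (λ c → g c ∧ (R ≤ᵇ part μ₁ c) ∧ bigᵇ μ₁ σ R c i) (from1 (length μ₁)) ≡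
    countᵇ (λ c → g c ∧ (R ≤ᵇ part μ₂ c) ∧ bigᵇ μ₂ σ R c i) (from1 (length μ₂))
  countᵇ-row-≗ g R i 1≤R =
    trans (countᵇ-cong (λ c → cong₂ (λ p b → g c ∧ (R ≤ᵇ p) ∧ b) (part≡ c) (bigᵇ-≗ R c i)) (from1 (length μ₁)))
          (countᵇ-from1-stable _ _ _ (λ c → vanish ∘ inj₁) (λ c → vanish ∘ inj₂))
    where
    vanish : ∀ {c} → length μ₁ < c ⊎ length μ₂ < c → (g c ∧ (R ≤ᵇ part μ₂ c) ∧ bigᵇ μ₂ σ R c i) ≡ false
    vanish {c} len<c rewrite part₂-beyond len<c | >⇒≤ᵇ≡false {R} {0} 1≤R = ∧-zeroʳ (g c)

  codeEntry-≗ : ∀ i → codeEntry μ₁ σ i ≡ codeEntry μ₂ σ i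
  codeEntry-≗ i = if-cong (cong (rank μ₁ σ i <ᵇ_) (part≡ (σ i)))
    (λ e → cong₂ _+_
      (trans (cong (λ R → countᵇ (λ c → (σ i <ᵇ c) ∧ (R ≤ᵇ part μ₁ c) ∧ bigᵇ μ₁ σ R c i) (cols μ₁ σ)) row≡)
             (countᵇ-row-≗ (σ i <ᵇ_) _ i (1≤row e)))
      (trans (cong (λ R → countᵇ (λ c → (c <ᵇ σ i) ∧ (suc R ≤ᵇ part μ₁ c) ∧ bigᵇ μ₁ σ (suc R) c i) (cols μ₁ σ)) row≡)
             (countᵇ-row-≗ (_<ᵇ σ i) _ i (s≤s z≤n))))
    (λ _ → cong (σ i ∸ 1 +_) (countᵇ-row-≗ (σ i <ᵇ_) 1 i (s≤s z≤n)))
    where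
    row≡ : rowOf μ₁ σ i ≡ rowOf μ₂ σ i
    row≡ = cong (_∸ rank μ₁ σ i) (part≡ (σ i))
    1≤row : inBoxᵇ μ₂ σ i ≡ true → 1 ≤ rowOf μ₂ σ i
    1≤row e = m<n⇒0<n∸m (<ᵇ≡true⇒< {rank μ₂ σ i} {part μ₂ (σ i)} e)

  emptyBoxes-≗ : emptyBoxes μ₁ σ ≡ emptyBoxes μ₂ σ
  emptyBoxes-≗ =
    trans (cong sum (map-cong emptyIn-≗ (from1 (length μ₁))))
          (sum-from1-stable (emptyIn μ₂ σ) _ _ (λ c → vanish ∘ inj₁) (λ c → vanish ∘ inj₂))
    where
    emptyIn-≗ : ∀ c → emptyIn μ₁ σ c ≡ emptyIn μ₂ σ c
    emptyIn-≗ c = trans (countᵇ-cong (λ r → cong is-nothing (content-≗ r c)) (from1 (part μ₁ c)))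
                        (cong (λ L → countᵇ (λ r → is-nothing (content μ₂ σ r c)) (from1 L)) (part≡ c))
    vanish : ∀ {c} → length μ₁ < c ⊎ length μ₂ < c → emptyIn μ₂ σ c ≡ 0
    vanish {c} len<c = cong (λ L → countᵇ (λ r → is-nothing (content μ₂ σ r c)) (from1 L)) (part₂-beyond len<c)

D-resp-part : ∀ {m} μ₁ μ₂ → (∀ c → part μ₁ c ≡ part μ₂ c) → ∀ {α} → D m μ₁ α → D m μ₂ α
D-resp-part {m} μ₁ μ₂ part≡ (σ , σ≥1 , one-empty , (decreasing , 1≤part₁ , empty₁₁) , floating , code≡) =
  σ , σ≥1 , trans (sym emptyBoxes-≗) one-empty ,
  (decreasing₂ , subst (1 ≤_) (part≡ 1) 1≤part₁ , trans (sym (content-≗ 1 1)) empty₁₁) ,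
  floating₂ , trans (sym (map-cong codeEntry-≗ (allFin m))) code≡
  where
  open PartwiseEqual μ₁ μ₂ part≡ σ
  decreasing₂ : RowsDecrease μ₂ σ
  decreasing₂ r c c' k k' 1≤r r≤c r≤c' c<c' e e' =
    decreasing r c c' k k' 1≤r (subst (r ≤_) (sym (part≡ c)) r≤c) (subst (r ≤_) (sym (part≡ c')) r≤c') c<c'
               (trans (content-≗ r c) e) (trans (content-≗ r c') e')
  floating₂ : Cond3 μ₂ σ
  floating₂ i not-in-box c' 1≤c' c'<σi with floating i (not-in-box ∘ subst (rank μ₁ σ i <_) (part≡ (σ i))) c' 1≤c' c'<σi
  ... | r , 1≤r , r≤part , big = r , 1≤r , subst (r ≤_) (part≡ c') r≤part , trans (sym (bigᵇ-≗ r c' i)) big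

data LastOfHeight (lam : List ℕ) : ℕ → ℕ → Set where
  empty  : ∀ {c₀} → c₀ ≡ suc (length lam) → LastOfHeight lam 0 c₀
  corner : ∀ {j c₀} → 1 ≤ j → 1 ≤ c₀ → part lam c₀ ≡ j → (∀ c → c₀ < c → part lam c < j) →
           LastOfHeight lam j c₀

lastOfHeight-1≤ : ∀ {lam j c₀} → LastOfHeight lam j c₀ → 1 ≤ c₀
lastOfHeight-1≤ (empty refl)         = s≤s z≤n
lastOfHeight-1≤ (corner _ 1≤c₀ _ _) = 1≤c₀

corner-conj : ∀ {lam j c₀} → Decreasing lam → 1 ≤ j → 1 ≤ c₀ → part lam c₀ ≡ j →
              (∀ c → c₀ < c → part lam c < j) → part (conj lam) j ≡ c₀
corner-conj {lam} {j} {c₀} lam↓ 1≤j 1≤c₀ part≡j shorter =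
  trans (part-conj lam j 1≤j) (≤-antisym count≤c₀ (≤-part⇒≤-countᵇ lam↓ c₀ j 1≤c₀ 1≤j (≤-reflexive (sym part≡j))))
  where
  count≤c₀ : countᵇ (j ≤ᵇ_) lam ≤ c₀
  count≤c₀ with countᵇ (j ≤ᵇ_) lam ≤? c₀
  ... | yes ≤c₀ = ≤c₀
  ... | no ≰c₀  = ⊥-elim (<⇒≱ (shorter (suc c₀) ≤-refl) (≤-countᵇ⇒≤-part lam↓ (suc c₀) j (s≤s z≤n) (≰⇒> ≰c₀)))

lastOfHeight⇒Defined : ∀ {lam j c₀} → Decreasing lam → LastOfHeight lam j c₀ → Defined lam j
lastOfHeight⇒Defined lam↓ (empty _) = inj₁ refl
lastOfHeight⇒Defined {lam} {j} {c₀} lam↓ (corner 1≤j 1≤c₀ part≡j shorter) =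
  inj₂ (1≤j , subst (part (conj lam) (suc j) <_) (sym (corner-conj lam↓ 1≤j 1≤c₀ part≡j shorter)) next<c₀)
  where
  next<c₀ : part (conj lam) (suc j) < c₀
  next<c₀ rewrite part-conj lam (suc j) (s≤s z≤n) with c₀ ≤? countᵇ (suc j ≤ᵇ_) lam
  ... | yes c₀≤ = ⊥-elim (1+n≰n (subst (suc j ≤_) part≡j (≤-countᵇ⇒≤-part lam↓ c₀ (suc j) 1≤c₀ c₀≤)))
  ... | no c₀≰  = ≰⇒> c₀≰

columnOf : List ℕ → ℕ → ℕ
columnOf lam zero    = suc (length lam)
columnOf lam (suc j) = part (conj lam) (suc j)

Defined⇒lastOfHeight : ∀ {lam} → Decreasing lam → ∀ j → Defined lam j → LastOfHeight lam j (columnOf lam j)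
Defined⇒lastOfHeight lam↓ zero    _                  = empty refl
Defined⇒lastOfHeight lam↓ (suc j) (inj₁ ())
Defined⇒lastOfHeight {lam} lam↓ (suc j) (inj₂ (1≤j , next<c₀)) = corner 1≤j 1≤c₀ part≡j shorter
  where
  c₀ : ℕ
  c₀ = part (conj lam) (suc j)
  c₀≡ : c₀ ≡ countᵇ (suc j ≤ᵇ_) lam
  c₀≡ = part-conj lam (suc j) 1≤j
  next≡ : part (conj lam) (suc (suc j)) ≡ countᵇ (suc (suc j) ≤ᵇ_) lam
  next≡ = part-conj lam (suc (suc j)) (s≤s z≤n)
  1≤c₀ : 1 ≤ c₀
  1≤c₀ = ≤-trans (s≤s z≤n) next<c₀
  part≡j : part lam c₀ ≡ suc j
  part≡j with suc (suc j) ≤? part lam c₀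
  ... | yes ≤part = ⊥-elim (<⇒≱ next<c₀ (subst (c₀ ≤_) (sym next≡) (≤-part⇒≤-countᵇ lam↓ c₀ (suc (suc j)) 1≤c₀ (s≤s z≤n) ≤part)))
  ... | no ≰part  = ≤-antisym (≤-pred (≰⇒> ≰part)) (≤-countᵇ⇒≤-part lam↓ c₀ (suc j) 1≤c₀ (≤-reflexive c₀≡))
  shorter : ∀ c → c₀ < c → part lam c < suc j
  shorter c c₀<c with suc j ≤? part lam c
  ... | yes ≤part = ⊥-elim (<⇒≱ c₀<c (subst (c ≤_) (sym c₀≡) (≤-part⇒≤-countᵇ lam↓ c (suc j) (≤-trans (s≤s z≤n) c₀<c) 1≤j ≤part)))
  ... | no ≰part  = ≰⇒> ≰part

part-decAt-lastOfHeight : ∀ {lam} → Decreasing lam → ∀ {j c₀} → LastOfHeight lam j c₀ →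
                          ∀ c → part (decAt c₀ lam) c ≡ part (lamj lam j) c
part-decAt-lastOfHeight {lam} _ (empty refl) c = cong (λ xs → part xs c) (decAt-beyond-length lam _ ≤-refl)
part-decAt-lastOfHeight lam↓ {zero} (corner () _ _ _) c
part-decAt-lastOfHeight lam↓ {suc j} (corner 1≤j 1≤c₀ part≡j shorter) zero = refl
part-decAt-lastOfHeight {lam} lam↓ {suc j} {c₀} (corner 1≤j 1≤c₀ part≡j shorter) (suc c) =
  +-cancelʳ-≡ (𝟙 (suc c ≡ᵇ c₀)) _ _ (begin
    part (decAt c₀ lam) (suc c) + 𝟙 (suc c ≡ᵇ c₀)                          ≡⟨ part-decAt lam c₀ (suc c) (subst (1 ≤_) (sym part≡j) 1≤j) ⟩
    part lam (suc c)                                                      ≡⟨ part-lamj lam↓ j (suc c) (s≤s z≤n) ⟨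
    part (lamj lam (suc j)) (suc c) + 𝟙 (suc c ≡ᵇ part (conj lam) (suc j)) ≡⟨ cong (λ z → part (lamj lam (suc j)) (suc c) + 𝟙 (suc c ≡ᵇ z))
                                                                                    (corner-conj lam↓ 1≤j 1≤c₀ part≡j shorter) ⟩
    part (lamj lam (suc j)) (suc c) + 𝟙 (suc c ≡ᵇ c₀)                      ∎)
  where open ≡-Reasoning

codeEntry-zero-floating : ∀ {m} lam (σ : Fin (suc m) → ℕ) → All (1 ≤_) lam → σ zero ≡ suc (length lam) →
                          codeEntry lam σ zero ≡ part (conj lam) 1
codeEntry-zero-floating lam σ lam≥1 σ₀≡ = begin
  codeEntry lam σ zero             ≡⟨ if-false not-in-box ⟩
  (σ zero ∸ 1) + countᵇ right (cols lam σ) ≡⟨ cong₂ _+_ (cong (_∸ 1) σ₀≡) nothing-right ⟩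
  length lam + 0                   ≡⟨ +-identityʳ _ ⟩
  length lam                       ≡⟨ countᵇ-1≤ᵇ lam≥1 ⟨
  countᵇ (1 ≤ᵇ_) lam               ≡⟨ part-conj lam 1 (s≤s z≤n) ⟨
  part (conj lam) 1                ∎
  where
  open ≡-Reasoning
  open Peel lam σ using (rank-zero)
  right : ℕ → Bool
  right c = (σ zero <ᵇ c) ∧ (1 ≤ᵇ part lam c) ∧ bigᵇ lam σ 1 c zero
  not-in-box : inBoxᵇ lam σ zero ≡ false
  not-in-box = cong₂ _<ᵇ_ rank-zero (trans (cong (part lam) σ₀≡) (part-beyond-length lam _ ≤-refl))
  nothing-right : countᵇ right (cols lam σ) ≡ 0
  nothing-right = trans (countᵇ-cong-from1 {q = λ _ → false} (length lam) λ c _ c≤len →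
                           cong (_∧ ((1 ≤ᵇ part lam c) ∧ bigᵇ lam σ 1 c zero))
                                (≥⇒<ᵇ≡false (≤-trans c≤len (≤-trans (n≤1+n _) (≤-reflexive (sym σ₀≡))))))
                        (countᵇ-false _ (λ _ → refl) (cols lam σ))

-- In a corner box of row j + 1, the code of 1 counts the columns reaching row j + 2 (all left of it).
codeEntry-zero-corner : ∀ {m} lam (σ : Fin (suc m) → ℕ) j → part lam (σ zero) ≡ suc j →
                        (∀ c → σ zero < c → part lam c < suc j) →
                        codeEntry lam σ zero ≡ part (conj lam) (suc (suc j))
codeEntry-zero-corner lam σ j part≡ shorter = begin
  codeEntry lam σ zero                                      ≡⟨ if-true in-box ⟩
  countᵇ right (cols lam σ) + countᵇ below-left (cols lam σ) ≡⟨ cong₂ _+_ nothing-right below-left≡ ⟩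
  countᵇ ((suc (suc j) ≤ᵇ_) ∘ part lam) (from1 (length lam)) ≡⟨ countᵇ-part-from1 (suc (suc j) ≤ᵇ_) lam ⟩
  countᵇ (suc (suc j) ≤ᵇ_) lam                              ≡⟨ part-conj lam (suc (suc j)) (s≤s z≤n) ⟨
  part (conj lam) (suc (suc j))                             ∎
  where
  open ≡-Reasoning
  open Peel lam σ using (rank-zero)
  R : ℕ
  R = rowOf lam σ zero
  R≡ : R ≡ suc j
  R≡ = cong₂ _∸_ part≡ rank-zero
  right : ℕ → Bool
  right c = (σ zero <ᵇ c) ∧ (R ≤ᵇ part lam c) ∧ bigᵇ lam σ R c zero
  below-left : ℕ → Bool
  below-left c = (c <ᵇ σ zero) ∧ (suc R ≤ᵇ part lam c) ∧ bigᵇ lam σ (suc R) c zero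
  in-box : inBoxᵇ lam σ zero ≡ true
  in-box = cong₂ _<ᵇ_ rank-zero part≡
  nothing-right : countᵇ right (cols lam σ) ≡ 0
  nothing-right = countᵇ-false right right≡false (cols lam σ)
    where
    right≡false : ∀ c → right c ≡ false
    right≡false c with σ zero <? c
    ... | yes σ₀<c = trans (cong (λ x → (σ zero <ᵇ c) ∧ x ∧ bigᵇ lam σ R c zero)
                                 (>⇒≤ᵇ≡false (subst (part lam c <_) (sym R≡) (shorter c σ₀<c))))
                           (∧-zeroʳ _)
    ... | no σ₀≮c = cong (_∧ ((R ≤ᵇ part lam c) ∧ bigᵇ lam σ R c zero)) (≥⇒<ᵇ≡false (≮⇒≥ σ₀≮c))
  below-left≡ : countᵇ below-left (cols lam σ) ≡ countᵇ ((suc (suc j) ≤ᵇ_) ∘ part lam) (from1 (length lam))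
  below-left≡ = countᵇ-cong pointwise (cols lam σ)
    where
    pointwise : ∀ c → below-left c ≡ (suc (suc j) ≤ᵇ part lam c)
    pointwise c with c <? σ zero
    ... | yes c<σ₀ = trans (cong (_∧ ((suc R ≤ᵇ part lam c) ∧ bigᵇ lam σ (suc R) c zero)) (<⇒<ᵇ≡true c<σ₀))
                           (trans (cong₂ (λ r b → (suc r ≤ᵇ part lam c) ∧ b) R≡ (bigᵇ-zero lam σ (suc R) c (<⇒≢ c<σ₀)))
                                  (∧-identityʳ _))
    ... | no c≮σ₀ = trans (cong (_∧ ((suc R ≤ᵇ part lam c) ∧ bigᵇ lam σ (suc R) c zero)) (≥⇒<ᵇ≡false (≮⇒≥ c≮σ₀)))
                          (sym (>⇒≤ᵇ≡false low))
      where
      low : part lam c < suc (suc j)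
      low with m≤n⇒m<n∨m≡n (≮⇒≥ c≮σ₀)
      ... | inj₁ σ₀<c = ≤-trans (shorter c σ₀<c) (n≤1+n _)
      ... | inj₂ σ₀≡c = s≤s (≤-reflexive (trans (cong (part lam) (sym σ₀≡c)) part≡))

codeEntry-zero : ∀ {m} lam (σ : Fin (suc m) → ℕ) {j} → All (1 ≤_) lam → LastOfHeight lam j (σ zero) →
                 codeEntry lam σ zero ≡ part (conj lam) (suc j)
codeEntry-zero lam σ lam≥1 (empty σ₀≡)                = codeEntry-zero-floating lam σ lam≥1 σ₀≡
codeEntry-zero lam σ {zero}  _ (corner () _ _ _)
codeEntry-zero lam σ {suc j} _ (corner _ _ part≡ shorter) = codeEntry-zero-corner lam σ j part≡ shorter

no-empty-box-beyond-1 : ∀ {m} lam (σ : Fin m → ℕ) → Cond1 lam σ → 1 ≤ part lam 1 → content lam σ 1 1 ≡ nothing →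
                        ∀ r c → 2 ≤ c → c ≤ length lam → 1 ≤ r → r ≤ part lam c → content lam σ r c ≢ nothing
no-empty-box-beyond-1 lam σ one-empty 1≤part₁ empty₁₁ r c 2≤c c≤len 1≤r r≤part empty-rc =
  <⇒≱ (s≤s (s≤s z≤n)) (begin
    1 + 1                                       ≤⟨ +-mono-≤ (empty-in 1 1 ≤-refl 1≤part₁ empty₁₁) (empty-in c r 1≤r r≤part empty-rc) ⟩
    emptyIn lam σ 1 + emptyIn lam σ c           ≤⟨ f+f≤sum-from1 (emptyIn lam σ) (length lam) 1 c ≤-refl 2≤c c≤len ⟩
    emptyBoxes lam σ                            ≡⟨ one-empty ⟩
    1                                           ∎)
  where
  open ≤-Reasoning
  empty-in : ∀ c r → 1 ≤ r → r ≤ part lam c → content lam σ r c ≡ nothing → 1 ≤ emptyIn lam σ c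
  empty-in c r 1≤r r≤part e = 1≤countᵇ-from1 _ (part lam c) r 1≤r r≤part (cong is-nothing e)

mapₘ-suc-just : ∀ {m} (x : Maybe (Fin m)) {k} → mapₘ suc x ≡ just k → ∃[ a ] (x ≡ just a × k ≡ suc a)
mapₘ-suc-just (just a) refl = a , refl , refl

mapₘ-suc-nothing : ∀ {m} (x : Maybe (Fin m)) → mapₘ (Fin.suc {m}) x ≡ nothing → x ≡ nothing
mapₘ-suc-nothing nothing _ = refl

Admissible : ∀ {m} → List ℕ → (Fin m → ℕ) → Set
Admissible μ σ = IsContainer μ σ × Cond1 μ σ × Cond2 μ σ × Cond3 μ σ

admissible⇒D : ∀ {m} μ (σ : Fin m → ℕ) {α} → Admissible μ σ → code μ σ ≡ α → D m μ α
admissible⇒D μ σ (σ≥1 , one-empty , cond2 , floating) code≡ = σ , σ≥1 , one-empty , cond2 , floating , code≡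

module _ {m : ℕ} (lam : List ℕ) (σ : Fin (suc m) → ℕ) where
  open Peel lam σ

  σ₀-beyond-length : All (1 ≤_) lam → IsContainer lam σ → part lam (σ zero) ≡ 0 → length lam < σ zero
  σ₀-beyond-length lam≥1 σ≥1 part≡0 with σ zero ≤? length lam
  ... | yes σ₀≤len = ⊥-elim (<⇒≱ (subst (1 ≤_) part≡0 (part-positive lam≥1 (σ zero) (σ≥1 zero) σ₀≤len)) z≤n)
  ... | no σ₀≰len  = ≰⇒> σ₀≰len

  floating-one-column : All (1 ≤_) lam → IsContainer lam σ → Cond3 lam σ → part lam (σ zero) ≡ 0 →
                        σ zero ≡ suc (length lam)
  floating-one-column lam≥1 σ≥1 floating part≡0 = ≤-antisym σ₀≤ (σ₀-beyond-length lam≥1 σ≥1 part≡0)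
    where
    σ₀≤ : σ zero ≤ suc (length lam)
    σ₀≤ with σ zero ≤? suc (length lam)
    ... | yes ≤len = ≤len
    ... | no ≰len with floating zero (λ in-box → <⇒≱ (subst₂ _<_ rank-zero part≡0 in-box) z≤n) (suc (length lam)) (s≤s z≤n) (≰⇒> ≰len)
    ...   | r , 1≤r , r≤part , _ = ⊥-elim (<⇒≱ 1≤r (subst (r ≤_) (part-beyond-length lam (suc (length lam)) ≤-refl) r≤part))

  -- Removing a floating 1 leaves λ unchanged, so |λ| ≤ 1 + m by counting.
  floating-one-size : All (1 ≤_) lam → IsContainer lam σ → Cond1 lam σ → part lam (σ zero) ≡ 0 → size lam ≤ suc m
  floating-one-size lam≥1 σ≥1 one-empty part≡0 = begin
    size lam               ≡⟨ cong size (decAt-beyond-length lam (σ zero) (σ₀-beyond-length lam≥1 σ≥1 part≡0)) ⟨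
    size μ⁻                ≤⟨ size≤emptyBoxes+m m μ⁻ σ⁻ ⟩
    emptyBoxes μ⁻ σ⁻ + m   ≡⟨ cong (_+ m) (trans (sym emptyBoxes-peel) one-empty) ⟩
    suc m                  ∎
    where open ≤-Reasoning

  -- The right neighbour of the box holding 1 is neither empty (condition (1)) nor smaller (condition (2)).
  boxed-one-corner : ∀ {p} → Decreasing lam → IsContainer lam σ → Cond1 lam σ → Cond2 lam σ →
                     part lam (σ zero) ≡ suc p → ∀ c → σ zero < c → part lam c < suc p
  boxed-one-corner {p} lam↓ σ≥1 one-empty (decreasing , 1≤part₁ , empty₁₁) part≡ c σ₀<c =
    ≤-<-trans (part-antitone lam↓ (suc (σ zero)) c (s≤s z≤n) σ₀<c) next-shorter
    where
    one-at : content lam σ (suc p) (σ zero) ≡ just zero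
    one-at = subst (λ q → content lam σ q (σ zero) ≡ just zero) part≡ content-σ₀
    next-shorter : part lam (suc (σ zero)) < suc p
    next-shorter with suc p ≤? part lam (suc (σ zero))
    ... | no ≰ = ≰⇒> ≰
    ... | yes ≤part with content lam σ (suc p) (suc (σ zero)) in e
    ...   | nothing = ⊥-elim (no-empty-box-beyond-1 lam σ one-empty 1≤part₁ empty₁₁ (suc p) (suc (σ zero)) (s≤s (σ≥1 zero))
                                (1≤part⇒≤length lam (suc (σ zero)) (≤-trans (s≤s z≤n) ≤part)) (s≤s z≤n) ≤part e)
    ...   | just k  = ⊥-elim (<⇒≱ (decreasing (suc p) (σ zero) (suc (σ zero)) zero k (s≤s z≤n) (≤-reflexive (sym part≡))
                                             ≤part ≤-refl one-at e) z≤n)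

  lastOfHeight-one : IsPartition lam → Admissible lam σ →
                     ∃[ j ] (LastOfHeight lam j (σ zero) × (j ≡ 0 → size lam ≤ suc m))
  lastOfHeight-one (lam↓ , lam≥1) (σ≥1 , one-empty , cond2 , floating) with part lam (σ zero) in part≡
  ... | zero  = 0 , empty (floating-one-column lam≥1 σ≥1 floating part≡) , λ _ → floating-one-size lam≥1 σ≥1 one-empty part≡
  ... | suc p = suc p , corner (s≤s z≤n) (σ≥1 zero) part≡ (boxed-one-corner lam↓ σ≥1 one-empty cond2 part≡) , λ ()

  admissible-peel : Admissible lam σ → Admissible μ⁻ σ⁻
  admissible-peel (σ≥1 , one-empty , (decreasing , 1≤part₁ , empty₁₁) , floating) =
    σ≥1 ∘ suc , trans (sym emptyBoxes-peel) one-empty , (decreasing⁻ , 1≤part⁻₁ , empty⁻₁₁) , floating⁻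
    where
    decreasing⁻ : RowsDecrease μ⁻ σ⁻
    decreasing⁻ r c c' k k' 1≤r r≤c r≤c' c<c' e e' =
      ≤-pred (decreasing r c c' (suc k) (suc k') 1≤r
                (≤-trans r≤c (part-decAt-≤ lam (σ zero) c)) (≤-trans r≤c' (part-decAt-≤ lam (σ zero) c')) c<c'
                (trans (content-suc r c 1≤r r≤c) (cong (mapₘ suc) e)) (trans (content-suc r c' 1≤r r≤c') (cong (mapₘ suc) e')))
    -- If 1 sits in column 1, the empty box (1,1) lies above it.
    1≤part⁻₁ : 1 ≤ part μ⁻ 1
    1≤part⁻₁ with σ zero ≟ 1
    ... | no σ₀≢1 = subst (1 ≤_) (sym (part-decAt-≢ lam (σ zero) 1 (σ₀≢1 ∘ sym))) 1≤part₁
    ... | yes σ₀≡1 = subst (1 ≤_) (sym (subst (λ c → part μ⁻ c ≡ part lam c ∸ 1) σ₀≡1 part-μ⁻-σ₀)) (2≤part₁ (part lam 1) refl)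
      where
      one-at-bottom : content lam σ (part lam 1) 1 ≡ just zero
      one-at-bottom = subst (λ c → content lam σ (part lam c) c ≡ just zero) σ₀≡1 content-σ₀
      2≤part₁ : ∀ x → part lam 1 ≡ x → 1 ≤ x ∸ 1
      2≤part₁ zero          e = ⊥-elim (<⇒≱ (subst (1 ≤_) e 1≤part₁) z≤n)
      2≤part₁ (suc zero)    e with () ← trans (sym (subst (λ q → content lam σ q 1 ≡ just zero) e one-at-bottom)) empty₁₁
      2≤part₁ (suc (suc _)) e = s≤s z≤n
    empty⁻₁₁ : content μ⁻ σ⁻ 1 1 ≡ nothing
    empty⁻₁₁ = mapₘ-suc-nothing _ (trans (sym (content-suc 1 1 (s≤s z≤n) 1≤part⁻₁)) empty₁₁)
    floating⁻ : Cond3 μ⁻ σ⁻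
    floating⁻ i not-in-box c' 1≤c' c'<σi
      with floating (suc i) (λ in-box → not-in-box (<ᵇ≡true⇒< {rank μ⁻ σ⁻ i} {part μ⁻ (σ⁻ i)}
                                          (trans (sym (inBoxᵇ-suc i)) (<⇒<ᵇ≡true in-box)))) c' 1≤c' c'<σi
    ... | r , 1≤r , r≤part , big = r , 1≤r , ≤ᵇ≡true⇒≤ (∧≡true⇒ˡ big⁻) , ∧≡true⇒ʳ big⁻
      where
      big⁻ : ((r ≤ᵇ part μ⁻ c') ∧ bigᵇ μ⁻ σ⁻ r c' i) ≡ true
      big⁻ = trans (sym (bigᵇ-suc r c' i 1≤r)) (cong₂ _∧_ (≤⇒≤ᵇ≡true r≤part) big)

  right-of-one-shorter : ∀ {j c} → LastOfHeight lam j (σ zero) → 1 ≤ part lam (σ zero) → σ zero < c →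
                         part lam c < part lam (σ zero)
  right-of-one-shorter (empty σ₀≡) 1≤part _ =
    ⊥-elim (<⇒≱ 1≤part (≤-reflexive (trans (cong (part lam) σ₀≡) (part-beyond-length lam _ ≤-refl))))
  right-of-one-shorter {c = c} (corner _ _ part≡j shorter) _ σ₀<c = subst (part lam c <_) (sym part≡j) (shorter c σ₀<c)

  floating-one : ∀ {j} → All (1 ≤_) lam → LastOfHeight lam j (σ zero) → ¬ InBox lam σ zero →
                 ∀ c → 1 ≤ c → c < σ zero → ∃[ r ] ((1 ≤ r) × (r ≤ part lam c) × (bigᵇ lam σ r c zero ≡ true))
  floating-one lam≥1 (empty σ₀≡) _ c 1≤c c<σ₀ =
    1 , ≤-refl , part-positive lam≥1 c 1≤c (≤-pred (subst (c <_) σ₀≡ c<σ₀)) , bigᵇ-zero lam σ 1 c (<⇒≢ c<σ₀)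
  floating-one lam≥1 (corner 1≤j _ part≡j _) not-in-box =
    ⊥-elim (not-in-box (subst₂ _<_ (sym rank-zero) (sym part≡j) 1≤j))

  admissible-unpeel : ∀ {j} → All (1 ≤_) lam → LastOfHeight lam j (σ zero) → Admissible μ⁻ σ⁻ → Admissible lam σ
  admissible-unpeel lam≥1 last (σ⁻≥1 , one-empty , (decreasing⁻ , 1≤part⁻₁ , empty⁻₁₁) , floating⁻) =
    σ≥1 , trans emptyBoxes-peel one-empty , (decreasing , 1≤part₁ , empty₁₁) , floating
    where
    σ≥1 : IsContainer lam σ
    σ≥1 zero    = lastOfHeight-1≤ last
    σ≥1 (suc k) = σ⁻≥1 k
    decreasing : RowsDecrease lam σ
    decreasing r c c' k k' 1≤r r≤c r≤c' c<c' e e' with r ≤? part μ⁻ c | r ≤? part μ⁻ c'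
    ... | yes r≤c⁻ | yes r≤c'⁻
      with mapₘ-suc-just (content μ⁻ σ⁻ r c) (trans (sym (content-suc r c 1≤r r≤c⁻)) e)
         | mapₘ-suc-just (content μ⁻ σ⁻ r c') (trans (sym (content-suc r c' 1≤r r≤c'⁻)) e')
    ...   | a , e⁻ , refl | a' , e'⁻ , refl = s≤s (decreasing⁻ r c c' a a' 1≤r r≤c⁻ r≤c'⁻ c<c' e⁻ e'⁻)
    decreasing r c c' k k' 1≤r r≤c r≤c' c<c' e e' | no r≰c⁻ | _ with removed-box r c r≤c r≰c⁻
    ... | refl , refl = ⊥-elim (<⇒≱ (right-of-one-shorter last 1≤r c<c') r≤c')
    decreasing r c c' k k' 1≤r r≤c r≤c' c<c' e e' | yes r≤c⁻ | no r≰c'⁻ with removed-box r c' r≤c' r≰c'⁻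
    ... | refl , refl with trans (sym e') content-σ₀ | k | content-column lam σ r c e
    ...   | refl | zero  | σ₀≡c = ⊥-elim (<⇒≢ c<c' (sym σ₀≡c))
    ...   | refl | suc _ | _    = s≤s z≤n
    1≤part₁ : 1 ≤ part lam 1
    1≤part₁ = ≤-trans 1≤part⁻₁ (part-decAt-≤ lam (σ zero) 1)
    empty₁₁ : content lam σ 1 1 ≡ nothing
    empty₁₁ = trans (content-suc 1 1 (s≤s z≤n) 1≤part⁻₁) (cong (mapₘ suc) empty⁻₁₁)
    floating : Cond3 lam σ
    floating zero = floating-one lam≥1 last
    floating (suc i) not-in-box c' 1≤c' c'<σi
      with floating⁻ i (λ in-box → not-in-box (<ᵇ≡true⇒< {rank lam σ (suc i)} {part lam (σ (suc i))}
                                                (trans (inBoxᵇ-suc i) (<⇒<ᵇ≡true in-box)))) c' 1≤c' c'<σi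
    ... | r , 1≤r , r≤part , big = r , 1≤r , ≤ᵇ≡true⇒≤ (∧≡true⇒ˡ big') , ∧≡true⇒ʳ big'
      where
      big' : ((r ≤ᵇ part lam c') ∧ bigᵇ lam σ r c' (suc i)) ≡ true
      big' = trans (bigᵇ-suc r c' i 1≤r) (cong₂ _∧_ (≤⇒≤ᵇ≡true r≤part) big)

D-suc⇒ : ∀ m lam → IsPartition lam → ∀ {α} → D (suc m) lam α →
         ∃[ j ] ∃[ β ] (ValidIndex (suc m) lam j × D m (lamj lam j) β × (α ≡ part (conj lam) (suc j) ∷ β))
D-suc⇒ m lam lam-partition@(lam↓ , lam≥1) {α} (σ , σ≥1 , one-empty , cond2 , floating , code≡)
  with lastOfHeight-one lam σ lam-partition (σ≥1 , one-empty , cond2 , floating)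
... | j , last , size≤ =
  j , code μ⁻ σ⁻ , (lastOfHeight⇒Defined lam↓ last , size≢) ,
  D-resp-part μ⁻ (lamj lam j) (part-decAt-lastOfHeight lam↓ last) (admissible⇒D μ⁻ σ⁻ (admissible-peel lam σ adm) refl) ,
  (begin
    α                                             ≡⟨ code≡ ⟨
    code lam σ                                    ≡⟨ code-peel ⟩
    codeEntry lam σ zero ∷ code μ⁻ σ⁻             ≡⟨ cong (_∷ code μ⁻ σ⁻) (codeEntry-zero lam σ lam≥1 last) ⟩
    part (conj lam) (suc j) ∷ code μ⁻ σ⁻          ∎)
  where
  open Peel lam σ
  open ≡-Reasoning
  adm : Admissible lam σ
  adm = σ≥1 , one-empty , cond2 , floating
  size≢ : j ≡ 0 → ¬ (size lam ≡ suc (suc m))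
  size≢ j≡0 size≡ = <⇒≱ (≤-reflexive (sym size≡)) (size≤ j≡0)

⇒D-suc : ∀ m lam → IsPartition lam → ∀ {α} j β → ValidIndex (suc m) lam j → D m (lamj lam j) β →
         α ≡ part (conj lam) (suc j) ∷ β → D (suc m) lam α
⇒D-suc m lam (lam↓ , lam≥1) {α} j β (defined , _) d α≡ =
  unpeel (D-resp-part (lamj lam j) (decAt c₀ lam) (sym ∘ part-decAt-lastOfHeight lam↓ last) d)
  where
  c₀ : ℕ
  c₀ = columnOf lam j
  last : LastOfHeight lam j c₀
  last = Defined⇒lastOfHeight lam↓ j defined
  unpeel : D m (decAt c₀ lam) β → D (suc m) lam α
  unpeel (σ⁻ , σ⁻≥1 , one-empty , cond2 , floating , code≡) =
    admissible⇒D lam σ (admissible-unpeel lam σ lam≥1 last (σ⁻≥1 , one-empty , cond2 , floating)) (begin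
      code lam σ                            ≡⟨ code-peel ⟩
      codeEntry lam σ zero ∷ code (decAt c₀ lam) σ⁻ ≡⟨ cong₂ _∷_ (codeEntry-zero lam σ lam≥1 last) code≡ ⟩
      part (conj lam) (suc j) ∷ β           ≡⟨ α≡ ⟨
      α                                     ∎)
    where
    σ : Fin (suc m) → ℕ
    σ = c₀ ∷ᶠ σ⁻
    open Peel lam σ using (code-peel)
    open ≡-Reasoning

part-conj-suc-< : ∀ lam {j j'} → j < j' → Defined lam j' → part (conj lam) (suc j') < part (conj lam) (suc j)
part-conj-suc-< lam j<j' (inj₁ refl) = ⊥-elim (<⇒≱ j<j' z≤n)
part-conj-suc-< lam {j} {j'} j<j' (inj₂ (1≤j' , drop)) = <-≤-trans drop (begin
  part (conj lam) j'          ≡⟨ part-conj lam j' 1≤j' ⟩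
  countᵇ (j' ≤ᵇ_) lam         ≤⟨ countᵇ-antitone lam j<j' ⟩
  countᵇ (suc j ≤ᵇ_) lam      ≡⟨ part-conj lam (suc j) (s≤s z≤n) ⟨
  part (conj lam) (suc j)     ∎)
  where open ≤-Reasoning

part-conj-suc-injective : ∀ lam {j j'} → Defined lam j → Defined lam j' →
                             part (conj lam) (suc j) ≡ part (conj lam) (suc j') → j ≡ j'
part-conj-suc-injective lam {j} {j'} defined defined' e with <-cmp j j'
... | tri< j<j' _ _ = ⊥-elim (<⇒≢ (part-conj-suc-< lam j<j' defined') (sym e))
... | tri≈ _ j≡j' _ = j≡j'
... | tri> _ _ j'<j = ⊥-elim (<⇒≢ (part-conj-suc-< lam j'<j defined) e)

D-zero-nil : ∀ {μ β} → D 0 μ β → β ≡ []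
D-zero-nil (_ , _ , _ , _ , _ , code≡) = sym code≡

D-zero-[1] : D 0 (1 ∷ []) []
D-zero-[1] = (λ ()) , (λ ()) , refl , ((λ _ _ _ ()) , s≤s z≤n , refl) , (λ ()) , refl

D-1-[1] : ∀ α → D 1 (1 ∷ []) α ⇔ (α ≡ 1 ∷ [])
D-1-[1] α = mk⇔ to (λ { refl → ⇒D-suc 0 (1 ∷ []) partition 0 [] (inj₁ refl , λ _ ()) D-zero-[1] refl })
  where
  partition : IsPartition (1 ∷ [])
  partition = [-] , (s≤s z≤n ∷ [])
  to : D 1 (1 ∷ []) α → α ≡ 1 ∷ []
  to d with D-suc⇒ 0 (1 ∷ []) partition d
  ... | zero          , β , _                 , d₀                           , α≡ = trans α≡ (cong (1 ∷_) (D-zero-nil d₀))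
  ... | suc zero      , β , _                 , (_ , _ , _ , (_ , () , _) , _) , _
  ... | suc (suc _)   , β , (inj₁ () , _)     , _                            , _
  ... | suc (suc _)   , β , (inj₂ (_ , ()) , _) , _                          , _

D-1-[2] : ∀ α → D 1 (2 ∷ []) α ⇔ (α ≡ 0 ∷ [])
D-1-[2] α = mk⇔ to (λ { refl → ⇒D-suc 0 (2 ∷ []) partition 2 [] (inj₂ (s≤s z≤n , s≤s z≤n) , λ ()) D-zero-[1] refl })
  where
  partition : IsPartition (2 ∷ [])
  partition = [-] , (s≤s z≤n ∷ [])
  to : D 1 (2 ∷ []) α → α ≡ 0 ∷ []
  to d with D-suc⇒ 0 (2 ∷ []) partition d
  ... | zero              , β , (_ , size≢)         , _  , _  = ⊥-elim (size≢ refl refl)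
  ... | suc zero          , β , (inj₁ () , _)       , _  , _
  ... | suc zero          , β , (inj₂ (_ , s≤s ()) , _) , _ , _
  ... | suc (suc zero)    , β , _                   , d₀ , α≡ = trans α≡ (cong (0 ∷_) (D-zero-nil d₀))
  ... | suc (suc (suc _)) , β , (inj₁ () , _)       , _  , _
  ... | suc (suc (suc _)) , β , (inj₂ (_ , ()) , _) , _  , _

D-1-[1,1] : ∀ α → D 1 (1 ∷ 1 ∷ []) α ⇔ (α ≡ 0 ∷ [])
D-1-[1,1] α = mk⇔ to (λ { refl → ⇒D-suc 0 (1 ∷ 1 ∷ []) partition 1 [] (inj₂ (s≤s z≤n , s≤s z≤n) , λ ()) D-zero-[1] refl })
  where
  partition : IsPartition (1 ∷ 1 ∷ [])
  partition = (s≤s z≤n ∷ [-]) , (s≤s z≤n ∷ s≤s z≤n ∷ [])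
  to : D 1 (1 ∷ 1 ∷ []) α → α ≡ 0 ∷ []
  to d with D-suc⇒ 0 (1 ∷ 1 ∷ []) partition d
  ... | zero        , β , (_ , size≢)         , _  , _  = ⊥-elim (size≢ refl refl)
  ... | suc zero    , β , _                   , d₀ , α≡ = trans α≡ (cong (0 ∷_) (D-zero-nil d₀))
  ... | suc (suc _) , β , (inj₁ () , _)       , _  , _
  ... | suc (suc _) , β , (inj₂ (_ , ()) , _) , _  , _

-- The bounds on |λ| are not needed: the index condition j ≠ 0 when |λ| = n + 1 is all that matters.
propositionP : ((n : ℕ) → 1 < n → (lam : List ℕ) → IsPartition lam →
      1 ≤ size lam → size lam ≤ suc n →
      ((α : List ℕ) →
        D n lam α ⇔ (∃[ j ] ∃[ β ] (ValidIndex n lam j × D (n ∸ 1) (lamj lam j) β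
                                   × (α ≡ part (conj lam) (suc j) ∷ β))))
      × ((j j' : ℕ) (β β' : List ℕ) → ValidIndex n lam j → ValidIndex n lam j' →
          D (n ∸ 1) (lamj lam j) β → D (n ∸ 1) (lamj lam j') β' →
          part (conj lam) (suc j) ∷ β ≡ part (conj lam) (suc j') ∷ β' → j ≡ j'))
    × ((α : List ℕ) → D 1 (1 ∷ []) α ⇔ (α ≡ 1 ∷ []))
    × ((α : List ℕ) → D 1 (2 ∷ []) α ⇔ (α ≡ 0 ∷ []))
    × ((α : List ℕ) → D 1 (1 ∷ 1 ∷ []) α ⇔ (α ≡ 0 ∷ []))
propositionP =
  (λ { zero () ; (suc m) _ lam partition _ _ →
         (λ α → mk⇔ (D-suc⇒ m lam partition)
                    (λ { (j , β , valid , d , α≡) → ⇒D-suc m lam partition j β valid d α≡ })) ,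
         (λ { j j' _ _ (defined , _) (defined' , _) _ _ e →
                part-conj-suc-injective lam defined defined' (∷-injectiveˡ e) }) }) ,
  D-1-[1] , D-1-[2] , D-1-[1,1]
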